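{- For integers $n\ge 0$ and $j\ge 0$, let $a_{n,j,k}$ be the number of skew Dyck paths with $n$ steps, starting at level $0$, ending at level $k$, that contain exactly $j$ (contiguous) occurrences of the pattern up--down--left, and set $A_k(z,t)=\sum_{n,j}a_{n,j,k}z^nt^j$. Let $u_1=u_1(z,t)$ be the solution of $$2zu-z^4-u^2+z^4t-uz^3+zu^3-u^2z^2=0$$ of the form $u_1=\frac1z+O(z)$ (the unique solution behaving like $1/z$ as $z\to0$; the other two solutions tend to $0$). Then for every $k\ge0$, $$A_k(z,t)=\frac{1-zu_1}{z^2u_1^{k}}.$$ Moreover, writing $R(z,t)=\sum_{n,j}a_{2n,j,0}z^nt^j$ (so that $z$ counts half the length of paths returning to level $0$), $R$ is the unique formal power series in $z$ (with coefficients polynomial in $t$) with $R(0,t)=1$ satisfying $$z^2R^3-z(2-z)R^2+(1-z^2)R-1+z+z^2-tz^2=0.$$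
   Context: A skew Dyck path is a finite lattice path in the plane starting at $(0,0)$, using up steps $U=(1,1)$, down steps $D=(1,-1)$ and left steps $L=(-1,-1)$, never going below the line $y=0$, and never overlapping itself; equivalently, the contiguous pairs $UL$ and $LU$ never occur. The level of a point is its $y$-coordinate; a path ends at level $k$ if its final point has $y$-coordinate $k$. An occurrence of up--down--left is a contiguous triple of steps $UDL$. -}

module Defs where

open import Data.Nat using (ℕ; zero; suc; _∸_; _<_)
open import Data.Integer using (ℤ; +_; _+_; _*_; -_)
open import Data.List using (List; []; _∷_; concatMap)
open import Data.Bool using (Bool; true; false; _∧_)
open import Data.Product using (Σ; ∃; _×_)
open import Relation.Binary.PropositionalEquality using (_≡_)

data Step : Set where
  U D L : Step

words : ℕ → List (List Step)
words zero    = [] ∷ []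
words (suc n) = concatMap (λ w → (U ∷ w) ∷ (D ∷ w) ∷ (L ∷ w) ∷ []) (words n)

-- the pairs UL and LU never occur (= the path never overlaps itself)
noOverlap : List Step → Bool
noOverlap (U ∷ L ∷ s) = false
noOverlap (L ∷ U ∷ s) = false
noOverlap (x ∷ s)     = noOverlap s
noOverlap []          = true

endsAt : ℕ → ℕ → List Step → Bool
endsAt zero    zero    []  = true
endsAt (suc h) zero    []  = false
endsAt zero    (suc k) []  = false
endsAt (suc h) (suc k) []  = endsAt h k []
endsAt h       k (U ∷ s)   = endsAt (suc h) k s
endsAt zero    k (D ∷ s)   = false
endsAt (suc h) k (D ∷ s)   = endsAt h k s
endsAt zero    k (L ∷ s)   = false
endsAt (suc h) k (L ∷ s)   = endsAt h k s

countUDL : List Step → ℕ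
countUDL (U ∷ D ∷ L ∷ s) = suc (countUDL (D ∷ L ∷ s))
countUDL (x ∷ s)         = countUDL s
countUDL []              = 0

eqℕ : ℕ → ℕ → Bool
eqℕ zero    zero    = true
eqℕ (suc m) (suc n) = eqℕ m n
eqℕ _       _       = false

good : ℕ → ℕ → List Step → Bool
good j k p = noOverlap p ∧ endsAt 0 k p ∧ eqℕ (countUDL p) j

countTrue : (List Step → Bool) → List (List Step) → ℕ
countTrue P []       = 0
countTrue P (x ∷ xs) with P x
... | true  = suc (countTrue P xs)
... | false = countTrue P xs

a : ℕ → ℕ → ℕ → ℕ
a n j k = countTrue (good j k) (words n)

-- Formal power series in z and t with integer coefficients:
-- S n j is the coefficient of z^n t^j.

Series : Set
Series = ℕ → ℕ → ℤ

infix 4 _≋_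
_≋_ : Series → Series → Set
f ≋ g = ∀ n j → f n j ≡ g n j

sumTo : ℕ → (ℕ → ℤ) → ℤ
sumTo zero    f = f 0
sumTo (suc n) f = sumTo n f + f (suc n)

infixl 6 _⊕_ _⊝_
infixl 7 _⊛_
infixr 8 _^ₛ_

_⊕_ : Series → Series → Series
(f ⊕ g) n j = f n j + g n j

⊖_ : Series → Series
(⊖ f) n j = - f n j

_⊝_ : Series → Series → Series
f ⊝ g = f ⊕ (⊖ g)

_⊛_ : Series → Series → Series
(f ⊛ g) n j = sumTo n (λ p → sumTo j (λ q → f p q * g (n ∸ p) (j ∸ q)))

cst : ℤ → Series
cst c zero zero = c
cst c _    _    = + 0

𝟘 𝟙 : Series
𝟘 = cst (+ 0)
𝟙 = cst (+ 1)

Z T : Series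
Z (suc zero) zero = + 1
Z _ _ = + 0
T zero (suc zero) = + 1
T _ _ = + 0

_^ₛ_ : Series → ℕ → Series
f ^ₛ zero  = 𝟙
f ^ₛ suc n = f ⊛ (f ^ₛ n)

A : ℕ → Series
A k n j = + a n j k

Rser : Series
Rser n j = + a (n Data.Nat.+ n) j 0

-- u_1 is represented by v = z·u_1, a formal power series.
-- The cubic 2zu - z^4 - u^2 + z^4 t - u z^3 + z u^3 - u^2 z^2 = 0,
-- with u = v/z and multiplied by z^2, reads
--   2 z^2 v - z^6 - v^2 + z^6 t - z^4 v + v^3 - z^2 v^2 = 0.
cubicV : Series → Series
cubicV v = cst (+ 2) ⊛ Z ^ₛ 2 ⊛ v ⊝ Z ^ₛ 6 ⊝ v ^ₛ 2 ⊕ Z ^ₛ 6 ⊛ T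
           ⊝ Z ^ₛ 4 ⊛ v ⊕ v ^ₛ 3 ⊝ Z ^ₛ 2 ⊛ v ^ₛ 2

-- u = v/z = 1/z + O(z): coefficient of z^0 in v is exactly 1,
-- coefficient of z^1 in v is 0.
IsU1 : Series → Set
IsU1 v = (cubicV v ≋ 𝟘)
       × (v 0 0 ≡ + 1) × (∀ j → v 0 (suc j) ≡ + 0)
       × (∀ j → v 1 j ≡ + 0)

eqR : Series → Series
eqR R = Z ^ₛ 2 ⊛ R ^ₛ 3 ⊝ Z ⊛ (cst (+ 2) ⊝ Z) ⊛ R ^ₛ 2 ⊕ (𝟙 ⊝ Z ^ₛ 2) ⊛ R
        ⊝ 𝟙 ⊕ Z ⊕ Z ^ₛ 2 ⊝ T ⊛ Z ^ₛ 2

ConstOne : Series → Set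
ConstOne S = (S 0 0 ≡ + 1) × (∀ j → S 0 (suc j) ≡ + 0)

PolyCoeffs : Series → Set
PolyCoeffs S = ∀ n → ∃ λ d → ∀ j → d < j → S n j ≡ + 0

-- Paths are read by an automaton that records the level, the number of UDL's so far and just
-- enough of the last steps to forbid UL and LU and to detect UDL.  Splitting by the last step,
-- the generating functions P_k (paths at level k not ending in L) and Y_k (paths ending in L, or
-- in a D not preceded by U) satisfy linear equations involving level k + 1.  Write v = z u₁ = 1 + z² ε.
-- Multiplied by powers of v these become a system for v^(k+1) P_k and v^(k+1) Y_k that is
-- contractive for the z-adic topology, and z^k, z^k y also solve it because ε is a root of the
-- reduced cubic.  Hence v^(k+1) P_k = z^k, which gives A_k (the kernel method).  A root ε₀ exists as
-- the fixed point of a contraction.  For k = 0 the formula reads A_0 = -ε₀; as no path of odd length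
-- returns to level 0, ε₀ is even and R(z²) = -ε₀(z), which turns the cubic into the equation for R.
-- That equation has the shape R = 1 + z (…), so it has only one solution.

module Submission where

open import Defs
open import Level using (Level)
open import Algebra.Bundles using (CommutativeRing)
open import Algebra.Core using (Op₂)
open import Algebra.Structures using (IsCommutativeRing)
open import Data.Nat using (ℕ; zero; suc; _∸_; _≤_; z≤n)
open import Data.Nat.Properties using (m∸[m∸n]≡n; +-∸-assoc; n∸n≡0; ≤-refl; ≤-trans; n≤1+n)
open import Data.Product using (_,_)
import Relation.Binary.PropositionalEquality as ≡

-- Formal power series over a commutative ring

module _ {c ℓ : Level} (R : CommutativeRing c ℓ) where

  open CommutativeRing R

  isCommutativeRing-with-* : (_*′_ : Op₂ Carrier) → (∀ x y → (x *′ y) ≈ (x * y)) →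
                             IsCommutativeRing _≈_ _+_ _*′_ -_ 0# 1#
  isCommutativeRing-with-* _*′_ *′≈* = record
    { isRing = record
      { +-isAbelianGroup = +-isAbelianGroup
      ; *-cong     = λ x≈x′ y≈y′ → trans (*′≈* _ _) (trans (*-cong x≈x′ y≈y′) (sym (*′≈* _ _)))
      ; *-assoc    = λ x y z → trans (*′≈* _ _) (trans (*-congʳ (*′≈* x y))
                                 (trans (*-assoc x y z) (sym (trans (*′≈* _ _) (*-congˡ (*′≈* y z))))))
      ; *-identity = (λ x → trans (*′≈* 1# x) (*-identityˡ x)) , (λ x → trans (*′≈* x 1#) (*-identityʳ x))
      ; distrib    = (λ x y z → trans (*′≈* _ _) (trans (distribˡ x y z) (sym (+-cong (*′≈* x y) (*′≈* x z)))))
                   , (λ x y z → trans (*′≈* _ _) (trans (distribʳ x y z) (sym (+-cong (*′≈* y x) (*′≈* z x)))))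
      }
    ; *-comm = λ x y → trans (*′≈* x y) (trans (*-comm x y) (sym (*′≈* y x)))
    }

module PowerSeries {c ℓ : Level} (R : CommutativeRing c ℓ) where

  open CommutativeRing R hiding (isCommutativeRing)
  open import Algebra.Properties.CommutativeSemigroup +-commutativeSemigroup using (interchange)
  open import Relation.Binary.Reasoning.Setoid setoid

  PowerSeries : Set c
  PowerSeries = ℕ → Carrier

  infix  4 _≈ₚ_
  infixl 6 _+ₚ_
  infixl 7 _*ₚ_

  _≈ₚ_ : PowerSeries → PowerSeries → Set ℓ
  f ≈ₚ g = ∀ n → f n ≈ g n

  sum≤ : ℕ → (ℕ → Carrier) → Carrier
  sum≤ zero    h = h 0
  sum≤ (suc n) h = sum≤ n h + h (suc n)

  _+ₚ_ : PowerSeries → PowerSeries → PowerSeries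
  (f +ₚ g) n = f n + g n

  -ₚ_ : PowerSeries → PowerSeries
  (-ₚ f) n = - f n

  0ₚ 1ₚ : PowerSeries
  0ₚ n = 0#
  1ₚ zero    = 1#
  1ₚ (suc n) = 0#

  _*ₚ_ : PowerSeries → PowerSeries → PowerSeries
  (f *ₚ g) n = sum≤ n (λ p → f p * g (n ∸ p))

  sum≤-cong≤ : ∀ n {h k} → (∀ p → p ≤ n → h p ≈ k p) → sum≤ n h ≈ sum≤ n k
  sum≤-cong≤ zero    h≈k = h≈k 0 z≤n
  sum≤-cong≤ (suc n) h≈k =
    +-cong (sum≤-cong≤ n (λ p p≤n → h≈k p (≤-trans p≤n (n≤1+n n)))) (h≈k (suc n) ≤-refl)

  sum≤-cong : ∀ n {h k} → (∀ p → h p ≈ k p) → sum≤ n h ≈ sum≤ n k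
  sum≤-cong n h≈k = sum≤-cong≤ n (λ p _ → h≈k p)

  sum≤-+ : ∀ n h k → sum≤ n (λ p → h p + k p) ≈ sum≤ n h + sum≤ n k
  sum≤-+ zero    h k = refl
  sum≤-+ (suc n) h k = trans (+-congʳ (sum≤-+ n h k)) (interchange _ _ _ _)

  *-distribˡ-sum≤ : ∀ n a h → a * sum≤ n h ≈ sum≤ n (λ p → a * h p)
  *-distribˡ-sum≤ zero    a h = refl
  *-distribˡ-sum≤ (suc n) a h = trans (distribˡ a (sum≤ n h) (h (suc n))) (+-congʳ (*-distribˡ-sum≤ n a h))

  sum≤-zeros : ∀ n h → (∀ p → h p ≈ 0#) → sum≤ n h ≈ 0#
  sum≤-zeros zero    h h≈0 = h≈0 0
  sum≤-zeros (suc n) h h≈0 = trans (+-cong (sum≤-zeros n h h≈0) (h≈0 (suc n))) (+-identityˡ 0#)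

  sum≤-suc : ∀ n h → sum≤ (suc n) h ≈ h 0 + sum≤ n (λ p → h (suc p))
  sum≤-suc zero    h = refl
  sum≤-suc (suc n) h = trans (+-congʳ (sum≤-suc n h)) (+-assoc _ _ _)

  sum≤-reverse : ∀ n h → sum≤ n h ≈ sum≤ n (λ p → h (n ∸ p))
  sum≤-reverse zero    h = refl
  sum≤-reverse (suc n) h = begin
    sum≤ (suc n) h                                ≈⟨ sum≤-suc n h ⟩
    h 0 + sum≤ n (λ p → h (suc p))                ≈⟨ +-congˡ (sum≤-reverse n (λ p → h (suc p))) ⟩
    h 0 + sum≤ n (λ p → h (suc (n ∸ p)))          ≈⟨ +-comm _ _ ⟩
    sum≤ n (λ p → h (suc (n ∸ p))) + h 0          ≈⟨ +-cong (sum≤-cong≤ n λ p p≤n → reflexive (≡.cong h (≡.sym (+-∸-assoc 1 p≤n))))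
                                                             (reflexive (≡.cong h (≡.sym (n∸n≡0 n)))) ⟩
    sum≤ (suc n) (λ p → h (suc n ∸ p))            ∎

  *ₚ-cong : ∀ {f f′ g g′} → f ≈ₚ f′ → g ≈ₚ g′ → f *ₚ g ≈ₚ f′ *ₚ g′
  *ₚ-cong f≈f′ g≈g′ n = sum≤-cong n (λ p → *-cong (f≈f′ p) (g≈g′ (n ∸ p)))

  *ₚ-comm : ∀ f g → f *ₚ g ≈ₚ g *ₚ f
  *ₚ-comm f g n = trans (sum≤-reverse n _) (sum≤-cong≤ n λ p p≤n →
    trans (*-comm _ _) (*-congʳ (reflexive (≡.cong g (m∸[m∸n]≡n p≤n)))))

  *ₚ-identityˡ : ∀ f → 1ₚ *ₚ f ≈ₚ f
  *ₚ-identityˡ f zero    = *-identityˡ (f 0)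
  *ₚ-identityˡ f (suc n) = begin
    (1ₚ *ₚ f) (suc n)                             ≈⟨ sum≤-suc n _ ⟩
    1# * f (suc n) + sum≤ n (λ p → 0# * f (n ∸ p)) ≈⟨ +-cong (*-identityˡ _) (sum≤-zeros n _ (λ p → zeroˡ _)) ⟩
    f (suc n) + 0#                                ≈⟨ +-identityʳ _ ⟩
    f (suc n)                                     ∎

  *ₚ-distribʳ : ∀ f g h → (g +ₚ h) *ₚ f ≈ₚ g *ₚ f +ₚ h *ₚ f
  *ₚ-distribʳ f g h n = trans (sum≤-cong n (λ p → distribʳ _ _ _)) (sum≤-+ n _ _)

  shift : PowerSeries → PowerSeries
  shift f n = f (suc n)

  _·ₚ_ : Carrier → PowerSeries → PowerSeries
  (a ·ₚ g) n = a * g n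

  *ₚ-suc : ∀ f g n → (f *ₚ g) (suc n) ≈ f 0 * g (suc n) + (shift f *ₚ g) n
  *ₚ-suc f g n = sum≤-suc n _

  ·ₚ-*ₚ-assoc : ∀ a g h n → ((a ·ₚ g) *ₚ h) n ≈ a * (g *ₚ h) n
  ·ₚ-*ₚ-assoc a g h n = trans (sum≤-cong n (λ p → *-assoc _ _ _)) (sym (*-distribˡ-sum≤ n a _))

  -- Induction on the degree: *ₚ-suc peels the constant term off the left factor.
  *ₚ-assoc : ∀ f g h → (f *ₚ g) *ₚ h ≈ₚ f *ₚ (g *ₚ h)
  *ₚ-assoc f g h zero    = *-assoc _ _ _
  *ₚ-assoc f g h (suc n) = begin
    ((f *ₚ g) *ₚ h) (suc n)
      ≈⟨ *ₚ-suc (f *ₚ g) h n ⟩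
    f 0 * g 0 * h (suc n) + (shift (f *ₚ g) *ₚ h) n
      ≈⟨ +-congˡ (*ₚ-cong {g = h} (*ₚ-suc f g) (λ _ → refl) n) ⟩
    f 0 * g 0 * h (suc n) + ((f 0 ·ₚ shift g +ₚ shift f *ₚ g) *ₚ h) n
      ≈⟨ +-congˡ (*ₚ-distribʳ h _ _ n) ⟩
    f 0 * g 0 * h (suc n) + (((f 0 ·ₚ shift g) *ₚ h) n + ((shift f *ₚ g) *ₚ h) n)
      ≈⟨ +-congˡ (+-cong (·ₚ-*ₚ-assoc (f 0) (shift g) h n) (*ₚ-assoc (shift f) g h n)) ⟩
    f 0 * g 0 * h (suc n) + (f 0 * (shift g *ₚ h) n + (shift f *ₚ (g *ₚ h)) n)
      ≈⟨ sym (+-assoc _ _ _) ⟩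
    f 0 * g 0 * h (suc n) + f 0 * (shift g *ₚ h) n + (shift f *ₚ (g *ₚ h)) n
      ≈⟨ +-congʳ (trans (+-congʳ (*-assoc _ _ _)) (sym (distribˡ _ _ _))) ⟩
    f 0 * (g 0 * h (suc n) + (shift g *ₚ h) n) + (shift f *ₚ (g *ₚ h)) n
      ≈⟨ +-congʳ (*-congˡ (sym (*ₚ-suc g h n))) ⟩
    f 0 * (g *ₚ h) (suc n) + (shift f *ₚ (g *ₚ h)) n
      ≈⟨ sym (*ₚ-suc f (g *ₚ h) n) ⟩
    (f *ₚ (g *ₚ h)) (suc n) ∎

  isCommutativeRing : IsCommutativeRing _≈ₚ_ _+ₚ_ _*ₚ_ -ₚ_ 0ₚ 1ₚ
  isCommutativeRing = record
    { isRing = record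
      { +-isAbelianGroup = record
        { isGroup = record
          { isMonoid = record
            { isSemigroup = record
              { isMagma = record
                { isEquivalence = record
                  { refl  = λ n → refl
                  ; sym   = λ f≈g n → sym (f≈g n)
                  ; trans = λ f≈g g≈h n → trans (f≈g n) (g≈h n)
                  }
                ; ∙-cong = λ f≈f′ g≈g′ n → +-cong (f≈f′ n) (g≈g′ n)
                }
              ; assoc = λ f g h n → +-assoc (f n) (g n) (h n)
              }
            ; identity = (λ f n → +-identityˡ (f n)) , (λ f n → +-identityʳ (f n))
            }
          ; inverse = (λ f n → -‿inverseˡ (f n)) , (λ f n → -‿inverseʳ (f n))
          ; ⁻¹-cong = λ f≈g n → -‿cong (f≈g n)
          }
        ; comm = λ f g n → +-comm (f n) (g n)
        }
      ; *-cong     = *ₚ-cong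
      ; *-assoc    = *ₚ-assoc
      ; *-identity = *ₚ-identityˡ , (λ f n → trans (*ₚ-comm f 1ₚ n) (*ₚ-identityˡ f n))
      ; distrib    = (λ f g h n → trans (*ₚ-comm f (g +ₚ h) n)
                                    (trans (*ₚ-distribʳ f g h n) (+-cong (*ₚ-comm g f n) (*ₚ-comm h f n))))
                   , *ₚ-distribʳ
      }
    ; *-comm = *ₚ-comm
    }

  commutativeRing : CommutativeRing c ℓ
  commutativeRing = record { isCommutativeRing = isCommutativeRing }

open import Data.Nat using (_+_; _<_; s≤s; s≤s⁻¹; parity)
open import Data.Nat.Properties using (+-identityʳ; +-suc; ≤-<-trans; m∸n≤m; m≤n⇒∃[o]m+o≡n)
import Data.Nat.Properties
open import Data.Nat.ListAction using (sum)
open import Data.Nat.ListAction.Properties using (sum-++)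
open import Data.Integer as ℤ using (ℤ; +_)
import Data.Integer.Properties as ℤₚ
open import Data.Bool using (Bool; true; false; _∧_)
open import Data.Bool.Properties using (∧-zeroʳ)
open import Data.List using (List; []; _∷_; _++_; _∷ʳ_; map; foldl; concatMap)
open import Data.List.Properties using (map-++; map-cong; foldl-∷ʳ)
open import Data.List.Relation.Unary.All as All using (All; []; _∷_)
open import Data.Parity.Base using (_⁻¹)
open import Data.Parity.Properties using (suc-homo-⁻¹; ⁻¹-involutive; +-homo-+; p+p≡0ℙ)
open import Data.Fin using (zero; suc)
open import Data.Vec using (Vec; []; _∷_; lookup)
open import Data.Unit using (⊤; tt)
open import Data.Product using (Σ; _×_)
open import Data.Maybe using (nothing)
open import Algebra.Properties.CommutativeSemigroup Data.Nat.Properties.+-commutativeSemigroup using (interchange)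
open import Relation.Binary.Bundles using (Setoid)
import Relation.Binary.Reasoning.Setoid
open import Relation.Nullary.Decidable using (isYes; toWitness)
open import Relation.Binary.PropositionalEquality using (_≡_; refl; cong; cong₂; sym; trans; subst; module ≡-Reasoning)

-- Series in z and t as a commutative ring

module ℤ⟦t⟧ = PowerSeries ℤₚ.+-*-commutativeRing
module ℤ⟦t⟧⟦z⟧ = PowerSeries ℤ⟦t⟧.commutativeRing

sumTo≡sum≤ : ∀ n h → sumTo n h ≡ ℤ⟦t⟧.sum≤ n h
sumTo≡sum≤ zero    h = refl
sumTo≡sum≤ (suc n) h = cong (ℤ._+ h (suc n)) (sumTo≡sum≤ n h)

sum≤-apply : ∀ n (H : ℕ → ℕ → ℤ) j → ℤ⟦t⟧⟦z⟧.sum≤ n H j ≡ sumTo n (λ p → H p j)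
sum≤-apply zero    H j = refl
sum≤-apply (suc n) H j = cong (ℤ._+ H (suc n) j) (sum≤-apply n H j)

sumTo-cong≤ : ∀ n {h k : ℕ → ℤ} → (∀ p → p ≤ n → h p ≡ k p) → sumTo n h ≡ sumTo n k
sumTo-cong≤ n {h} {k} h≡k = trans (sumTo≡sum≤ n h) (trans (ℤ⟦t⟧.sum≤-cong≤ n h≡k) (sym (sumTo≡sum≤ n k)))

sumTo-zeros : ∀ n h → (∀ p → h p ≡ + 0) → sumTo n h ≡ + 0
sumTo-zeros n h h≡0 = trans (sumTo≡sum≤ n h) (ℤ⟦t⟧.sum≤-zeros n h h≡0)

sumTo-suc : ∀ n h → sumTo (suc n) h ≡ h 0 ℤ.+ sumTo n (λ p → h (suc p))
sumTo-suc n h = trans (sumTo≡sum≤ (suc n) h)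
  (trans (ℤ⟦t⟧.sum≤-suc n h) (cong (λ x → h 0 ℤ.+ x) (sym (sumTo≡sum≤ n _))))

sumTo-head : ∀ n h → (∀ p → h (suc p) ≡ + 0) → sumTo n h ≡ h 0
sumTo-head zero    h h≡0 = refl
sumTo-head (suc n) h h≡0 =
  trans (sumTo-suc n h) (trans (cong (λ x → h 0 ℤ.+ x) (sumTo-zeros n _ h≡0)) (ℤₚ.+-identityʳ (h 0)))

⊛≋*ₚ : ∀ f g → f ⊛ g ≋ ℤ⟦t⟧⟦z⟧._*ₚ_ f g
⊛≋*ₚ f g n j = sym (trans (sum≤-apply n _ j) (sumTo-cong≤ n (λ p _ → sym (sumTo≡sum≤ j _))))

seriesRing : CommutativeRing _ _
seriesRing = record
  { isCommutativeRing = isCommutativeRing-with-* ℤ⟦t⟧⟦z⟧.commutativeRing _⊛_ ⊛≋*ₚ }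

open CommutativeRing seriesRing using (0#; 1#)

≋-refl : ∀ {f} → f ≋ f
≋-refl n j = refl

≋-sym : ∀ {f g} → f ≋ g → g ≋ f
≋-sym f≋g n j = sym (f≋g n j)

≋-trans : ∀ {f g h} → f ≋ g → g ≋ h → f ≋ h
≋-trans f≋g g≋h n j = trans (f≋g n j) (g≋h n j)

≋-setoid : Setoid _ _
≋-setoid = record { Carrier = Series ; _≈_ = _≋_
                  ; isEquivalence = record { refl = ≋-refl ; sym = ≋-sym ; trans = ≋-trans } }

module ≋-Reasoning = Relation.Binary.Reasoning.Setoid ≋-setoid

⊕-cong : ∀ {f f′ g g′} → f ≋ f′ → g ≋ g′ → f ⊕ g ≋ f′ ⊕ g′
⊕-cong f≋f′ g≋g′ n j = cong₂ ℤ._+_ (f≋f′ n j) (g≋g′ n j)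

⊕-congˡ : ∀ {f g g′} → g ≋ g′ → f ⊕ g ≋ f ⊕ g′
⊕-congˡ {f} = ⊕-cong (≋-refl {f})

⊕-congʳ : ∀ {f f′ g} → f ≋ f′ → f ⊕ g ≋ f′ ⊕ g
⊕-congʳ {g = g} f≋f′ = ⊕-cong f≋f′ (≋-refl {g})

⊖-cong : ∀ {f f′} → f ≋ f′ → ⊖ f ≋ ⊖ f′
⊖-cong f≋f′ n j = cong ℤ.-_ (f≋f′ n j)

⊛-cong : ∀ {f f′ g g′} → f ≋ f′ → g ≋ g′ → f ⊛ g ≋ f′ ⊛ g′
⊛-cong {f} {f′} {g} {g′} = CommutativeRing.*-cong seriesRing {f} {f′} {g} {g′}

⊛-congˡ : ∀ {f g g′} → g ≋ g′ → f ⊛ g ≋ f ⊛ g′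
⊛-congˡ {f} = ⊛-cong (≋-refl {f})

⊛-congʳ : ∀ {f f′ g} → f ≋ f′ → f ⊛ g ≋ f′ ⊛ g
⊛-congʳ {g = g} f≋f′ = ⊛-cong f≋f′ (≋-refl {g})

cst≋0 : cst (+ 0) ≋ 0#
cst≋0 zero    zero    = refl
cst≋0 zero    (suc j) = refl
cst≋0 (suc n) j       = refl

cst≋1 : cst (+ 1) ≋ 1#
cst≋1 zero    zero    = refl
cst≋1 zero    (suc j) = refl
cst≋1 (suc n) j       = refl

cst-+ : ∀ a b → cst (a ℤ.+ b) ≋ cst a ⊕ cst b
cst-+ a b zero    zero    = refl
cst-+ a b zero    (suc j) = refl
cst-+ a b (suc n) j       = refl

cst-neg : ∀ a → cst (ℤ.- a) ≋ ⊖ cst a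
cst-neg a zero    zero    = refl
cst-neg a zero    (suc j) = refl
cst-neg a (suc n) j       = refl

cst-* : ∀ a b → cst (a ℤ.* b) ≋ cst a ⊛ cst b
cst-* a b zero    zero    = refl
cst-* a b zero    (suc j) = sym (sumTo-zeros (suc j) _ λ { zero → ℤₚ.*-zeroʳ a ; (suc q) → refl })
cst-* a b (suc n) j       = sym (sumTo-zeros (suc n) _ λ
  { zero    → sumTo-zeros j _ (λ { zero → ℤₚ.*-zeroʳ a ; (suc q) → refl })
  ; (suc p) → sumTo-zeros j _ (λ q → refl) })

-- Tactic.RingSolver.NonReflective takes its coefficients from the carrier, where constants do not
-- compute; here the same normaliser runs with coefficients in ℤ, interpreted by cst.
module SeriesSolver where

  open import Tactic.RingSolver.Core.AlmostCommutativeRing using (AlmostCommutativeRing; fromCommutativeRing)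
  open import Tactic.RingSolver.Core.Polynomial.Parameters using (Homomorphism)
  open import Tactic.RingSolver.Core.Expression public
    using (Expr; Ι)
    renaming (Κ to con; _⊕_ to _:+_; _⊗_ to _:*_; ⊝_ to :-_)
  open import Tactic.RingSolver.Core.Expression public using () renaming (_⊛_ to _:^ᴱ_)

  seriesACR : AlmostCommutativeRing _ _
  seriesACR = fromCommutativeRing seriesRing (λ _ → nothing)

  open AlmostCommutativeRing seriesACR using (setoid; rawRing; semiring)
  open import Algebra.Properties.Semiring.Exp.TCOptimised semiring using (^-congˡ)

  cstHomomorphism : Homomorphism _ _ _ _
  cstHomomorphism = record
    { from = record { rawRing = ℤ.+-*-rawRing ; isZero = λ x → isYes (x ℤ.≟ + 0) }
    ; to = seriesACR
    ; morphism = record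
      { ⟦_⟧ = cst ; +-homo = cst-+ ; *-homo = cst-* ; -‿homo = cst-neg ; 0-homo = cst≋0 ; 1-homo = cst≋1 }
    ; Zero-C⟶Zero-R = λ x x≡0 → zero-homo x (toWitness x≡0)
    }
    where
    zero-homo : ∀ x → x ≡ + 0 → 0# ≋ cst x
    zero-homo x refl = ≋-sym cst≋0

  open import Tactic.RingSolver.Core.Polynomial.Base (Homomorphism.from cstHomomorphism)
  open import Tactic.RingSolver.Core.Polynomial.Semantics cstHomomorphism renaming (⟦_⟧ to ⟦_⟧ₚ)
  open import Tactic.RingSolver.Core.Polynomial.Homomorphism cstHomomorphism
  open import Tactic.RingSolver.Core.Expression using (module Eval)
  open Eval rawRing cst public using (⟦_⟧)

  normalise : ∀ {n} → Expr ℤ n → Poly n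
  normalise (con x)   = κ x
  normalise (Ι x)     = ι x
  normalise (x :+ y)  = normalise x ⊞ normalise y
  normalise (x :* y)  = normalise x ⊠ normalise y
  normalise (:- x)    = ⊟ normalise x
  normalise (x :^ᴱ i) = normalise x ⊡ i

  ⟦_⇓⟧ : ∀ {n} → Expr ℤ n → Vec Series n → Series
  ⟦ e ⇓⟧ = ⟦ normalise e ⟧ₚ

  normalise-correct : ∀ {n} (e : Expr ℤ n) ρ → ⟦ e ⇓⟧ ρ ≋ ⟦ e ⟧ ρ
  normalise-correct (con x)   ρ = κ-hom x ρ
  normalise-correct (Ι x)     ρ = ι-hom x ρ
  normalise-correct (x :+ y)  ρ = ≋-trans (⊞-hom (normalise x) (normalise y) ρ) (⊕-cong (normalise-correct x ρ) (normalise-correct y ρ))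
  normalise-correct (x :* y)  ρ = ≋-trans (⊠-hom (normalise x) (normalise y) ρ) (⊛-cong (normalise-correct x ρ) (normalise-correct y ρ))
  normalise-correct (:- x)    ρ = ≋-trans (⊟-hom (normalise x) ρ) (⊖-cong (normalise-correct x ρ))
  normalise-correct (x :^ᴱ i) ρ = ≋-trans (⊡-hom (normalise x) i ρ) (^-congˡ i (normalise-correct x ρ))

  open import Relation.Binary.Reflection setoid Ι ⟦_⟧ ⟦_⇓⟧ normalise-correct public
    using (solve) renaming (_⊜_ to _:=_)

  infixl 6 _:-_
  infixr 8 _:^_

  _:-_ : ∀ {n} → Expr ℤ n → Expr ℤ n → Expr ℤ n
  x :- y = x :+ (:- y)

  -- Mirrors _^ₛ_, so that ⟦ x :^ k ⟧ is definitionally ⟦ x ⟧ ^ₛ k.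
  _:^_ : ∀ {n} → Expr ℤ n → ℕ → Expr ℤ n
  x :^ zero  = con (+ 1)
  x :^ suc k = x :* (x :^ k)

open SeriesSolver

≋⇒⊝≋𝟘 : ∀ {f g} → f ≋ g → f ⊝ g ≋ 𝟘
≋⇒⊝≋𝟘 {f} {g} f≋g = ≋-trans (⊕-congʳ {g = ⊖ g} f≋g) (solve 1 (λ g → g :- g := con (+ 0)) (λ _ _ → refl) g)

⊝≋𝟘⇒≋ : ∀ {f g} → f ⊝ g ≋ 𝟘 → f ≋ g
⊝≋𝟘⇒≋ {f} {g} f-g≋0 = begin
  f             ≈⟨ solve 2 (λ f g → f := f :- g :+ g) (λ _ _ → refl) f g ⟩
  f ⊝ g ⊕ g     ≈⟨ ⊕-congʳ {g = g} f-g≋0 ⟩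
  𝟘 ⊕ g         ≈⟨ solve 1 (λ g → con (+ 0) :+ g := g) (λ _ _ → refl) g ⟩
  g             ∎
  where open ≋-Reasoning

≋-by-scaled-difference : ∀ {f g} c {p q} → f ⊝ g ≋ c ⊛ (p ⊝ q) → p ≋ q → f ≋ g
≋-by-scaled-difference c {p} {q} f-g≋c[p-q] p≋q = ⊝≋𝟘⇒≋ (≋-trans f-g≋c[p-q]
  (≋-trans (⊛-congˡ {c} (≋⇒⊝≋𝟘 p≋q)) (solve 1 (λ c → c :* con (+ 0) := con (+ 0)) (λ _ _ → refl) c)))

^ₛ-cong : ∀ {f g} k → f ≋ g → f ^ₛ k ≋ g ^ₛ k
^ₛ-cong zero    f≋g = ≋-refl
^ₛ-cong (suc k) f≋g = ⊛-cong f≋g (^ₛ-cong k f≋g)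

-- z-adic agreement and contractions

Z⊛-zero : ∀ f j → (Z ⊛ f) 0 j ≡ + 0
Z⊛-zero f j = sumTo-zeros j _ (λ q → refl)

Z⊛-suc : ∀ f n j → (Z ⊛ f) (suc n) j ≡ f n j
Z⊛-suc f n j = begin
  (Z ⊛ f) (suc n) j                                     ≡⟨ sumTo-suc n _ ⟩
  sumTo j (λ q → Z 0 q ℤ.* f (suc n) (j ∸ q)) ℤ.+ sumTo n (λ p → sumTo j (λ q → Z (suc p) q ℤ.* f (n ∸ p) (j ∸ q)))
                                                        ≡⟨ cong₂ ℤ._+_ (sumTo-zeros j _ (λ q → refl))
                                                                       (sumTo-head n _ (λ p → sumTo-zeros j _ (λ q → refl))) ⟩
  + 0 ℤ.+ sumTo j (λ q → Z 1 q ℤ.* f n (j ∸ q))         ≡⟨ ℤₚ.+-identityˡ _ ⟩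
  sumTo j (λ q → Z 1 q ℤ.* f n (j ∸ q))                 ≡⟨ sumTo-head j _ (λ q → refl) ⟩
  + 1 ℤ.* f n j                                         ≡⟨ ℤₚ.*-identityˡ (f n j) ⟩
  f n j                                                 ∎
  where open ≡-Reasoning

T⊛-zero : ∀ f n → (T ⊛ f) n 0 ≡ + 0
T⊛-zero f n = sumTo-zeros n _ (λ { zero → refl ; (suc p) → refl })

T⊛-suc : ∀ f n j → (T ⊛ f) n (suc j) ≡ f n j
T⊛-suc f n j = begin
  (T ⊛ f) n (suc j)                                     ≡⟨ sumTo-head n _ (λ p → sumTo-zeros (suc j) _ (λ { zero → refl ; (suc q) → refl })) ⟩
  sumTo (suc j) (λ q → T 0 q ℤ.* f n (suc j ∸ q))       ≡⟨ sumTo-suc j _ ⟩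
  + 0 ℤ.+ sumTo j (λ q → T 0 (suc q) ℤ.* f n (j ∸ q))   ≡⟨ ℤₚ.+-identityˡ _ ⟩
  sumTo j (λ q → T 0 (suc q) ℤ.* f n (j ∸ q))           ≡⟨ sumTo-head j _ (λ q → refl) ⟩
  + 1 ℤ.* f n j                                         ≡⟨ ℤₚ.*-identityˡ (f n j) ⟩
  f n j                                                 ∎
  where open ≡-Reasoning

≋Z⊛ : ∀ {f g} → (∀ j → f 0 j ≡ + 0) → (∀ n j → f (suc n) j ≡ g n j) → f ≋ Z ⊛ g
≋Z⊛ {g = g} f₀≡0 f₊≡g zero    j = trans (f₀≡0 j) (sym (Z⊛-zero g j))
≋Z⊛ {g = g} f₀≡0 f₊≡g (suc n) j = trans (f₊≡g n j) (sym (Z⊛-suc g n j))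

Z⊛-cancel : ∀ f → Z ⊛ f ≋ 𝟘 → f ≋ 𝟘
Z⊛-cancel f zf≋0 n j = trans (sym (Z⊛-suc f n j)) (trans (zf≋0 (suc n) j) (𝟘-suc n j))
  where
  𝟘-suc : ∀ n j → 𝟘 (suc n) j ≡ 𝟘 n j
  𝟘-suc zero    zero    = refl
  𝟘-suc zero    (suc j) = refl
  𝟘-suc (suc n) j       = refl

Z²⊛≋Z⊛Z⊛ : ∀ f → Z ^ₛ 2 ⊛ f ≋ Z ⊛ (Z ⊛ f)
Z²⊛≋Z⊛Z⊛ f = solve 2 (λ z f → z :^ 2 :* f := z :* (z :* f)) (λ _ _ → refl) Z f

Z²⊛-cancel : ∀ f → Z ^ₛ 2 ⊛ f ≋ 𝟘 → f ≋ 𝟘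
Z²⊛-cancel f z²f≋0 = Z⊛-cancel f (Z⊛-cancel (Z ⊛ f) (≋-trans (≋-sym (Z²⊛≋Z⊛Z⊛ f)) z²f≋0))

infix 4 _≈[<_]_

_≈[<_]_ : Series → ℕ → Series → Set
f ≈[< n ] g = ∀ m j → m < n → f m j ≡ g m j

≋⇒≈[<] : ∀ {n f g} → f ≋ g → f ≈[< n ] g
≋⇒≈[<] f≋g m j _ = f≋g m j

≈[<]-refl : ∀ {n f} → f ≈[< n ] f
≈[<]-refl m j _ = refl

≈[<]-trans : ∀ {n f g h} → f ≈[< n ] g → g ≈[< n ] h → f ≈[< n ] h
≈[<]-trans f≈g g≈h m j m<n = trans (f≈g m j m<n) (g≈h m j m<n)

≈[<]-⊕ : ∀ {n f f′ g g′} → f ≈[< n ] f′ → g ≈[< n ] g′ → f ⊕ g ≈[< n ] f′ ⊕ g′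
≈[<]-⊕ f≈f′ g≈g′ m j m<n = cong₂ ℤ._+_ (f≈f′ m j m<n) (g≈g′ m j m<n)

≈[<]-⊖ : ∀ {n f f′} → f ≈[< n ] f′ → ⊖ f ≈[< n ] ⊖ f′
≈[<]-⊖ f≈f′ m j m<n = cong ℤ.-_ (f≈f′ m j m<n)

≈[<]-⊛ : ∀ {n f f′ g g′} → f ≈[< n ] f′ → g ≈[< n ] g′ → f ⊛ g ≈[< n ] f′ ⊛ g′
≈[<]-⊛ f≈f′ g≈g′ m j m<n = sumTo-cong≤ m λ p p≤m → sumTo-cong≤ j λ q _ →
  cong₂ ℤ._*_ (f≈f′ p q (≤-<-trans p≤m m<n)) (g≈g′ (m ∸ p) (j ∸ q) (≤-<-trans (m∸n≤m m p) m<n))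

Z⊛-≈[<] : ∀ {n f g} → f ≈[< n ] g → Z ⊛ f ≈[< suc n ] Z ⊛ g
Z⊛-≈[<] {f = f} {g} f≈g zero    j _         = trans (Z⊛-zero f j) (sym (Z⊛-zero g j))
Z⊛-≈[<] {f = f} {g} f≈g (suc m) j (s≤s m<n) = trans (Z⊛-suc f m j) (trans (f≈g m j m<n) (sym (Z⊛-suc g m j)))

≈[<]-all⇒≋ : ∀ {f g} → (∀ n → f ≈[< n ] g) → f ≋ g
≈[<]-all⇒≋ f≈g m j = f≈g (suc m) m j ≤-refl

polynomial-≈[<] : ∀ {k n} (e : Expr ℤ k) {ρ ρ′ : Vec Series k} →
                  (∀ i → lookup ρ i ≈[< n ] lookup ρ′ i) → ⟦ e ⟧ ρ ≈[< n ] ⟦ e ⟧ ρ′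
polynomial-≈[<] (con c)                ρ≈ρ′ = ≈[<]-refl
polynomial-≈[<] (Ι i)                  ρ≈ρ′ = ρ≈ρ′ i
polynomial-≈[<] (e :+ e′)              ρ≈ρ′ = ≈[<]-⊕ (polynomial-≈[<] e ρ≈ρ′) (polynomial-≈[<] e′ ρ≈ρ′)
polynomial-≈[<] (e :* e′)              ρ≈ρ′ = ≈[<]-⊛ (polynomial-≈[<] e ρ≈ρ′) (polynomial-≈[<] e′ ρ≈ρ′)
polynomial-≈[<] (:- e)                 ρ≈ρ′ = ≈[<]-⊖ (polynomial-≈[<] e ρ≈ρ′)
polynomial-≈[<] (e :^ᴱ zero)           ρ≈ρ′ = ≈[<]-refl
polynomial-≈[<] (e :^ᴱ suc zero)       ρ≈ρ′ = polynomial-≈[<] e ρ≈ρ′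
polynomial-≈[<] (e :^ᴱ suc (suc i))    ρ≈ρ′ = ≈[<]-⊛ (polynomial-≈[<] (e :^ᴱ suc i) ρ≈ρ′) (polynomial-≈[<] e ρ≈ρ′)

polynomial-cong : ∀ {k} (e : Expr ℤ k) {ρ ρ′ : Vec Series k} → (∀ i → lookup ρ i ≋ lookup ρ′ i) → ⟦ e ⟧ ρ ≋ ⟦ e ⟧ ρ′
polynomial-cong e ρ≋ρ′ = ≈[<]-all⇒≋ (λ n → polynomial-≈[<] e (λ i → ≋⇒≈[<] (ρ≋ρ′ i)))

module _ {I : Set} where

  ContractiveFamily : ((I → Series) → (I → Series)) → Set
  ContractiveFamily Φ = ∀ n F G → (∀ i → F i ≈[< n ] G i) → ∀ i → Φ F i ≈[< suc n ] Φ G i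

  contractiveFamily-fixedPoint-unique : ∀ Φ → ContractiveFamily Φ → ∀ F G →
    (∀ i → Φ F i ≋ F i) → (∀ i → Φ G i ≋ G i) → ∀ i → F i ≋ G i
  contractiveFamily-fixedPoint-unique Φ contr F G ΦF≋F ΦG≋G i = ≈[<]-all⇒≋ (λ n → agree n i)
    where
    agree : ∀ n i → F i ≈[< n ] G i
    agree zero    i m j ()
    agree (suc n) i = ≈[<]-trans (≋⇒≈[<] (≋-sym (ΦF≋F i)))
                        (≈[<]-trans (contr n F G (agree n) i) (≋⇒≈[<] (ΦG≋G i)))

Contractive : (Series → Series) → Set
Contractive Φ = ∀ n f g → f ≈[< n ] g → Φ f ≈[< suc n ] Φ g

contractive-fixedPoint-unique : ∀ Φ → Contractive Φ → ∀ f g → Φ f ≋ f → Φ g ≋ g → f ≋ g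
contractive-fixedPoint-unique Φ contr f g Φf≋f Φg≋g =
  contractiveFamily-fixedPoint-unique {I = ⊤} (λ F _ → Φ (F tt)) (λ n F G F≈G _ → contr n (F tt) (G tt) (F≈G tt))
    (λ _ → f) (λ _ → g) (λ _ → Φf≋f) (λ _ → Φg≋g) tt

-- The n-th iterate from 𝟘 is already correct below z^n.
module FixedPoint (Φ : Series → Series) (contr : Contractive Φ) where

  iterate : ℕ → Series
  iterate zero    = 𝟘
  iterate (suc m) = Φ (iterate m)

  iterate-stable : ∀ n r → iterate n ≈[< n ] iterate (n + r)
  iterate-stable zero    r m j ()
  iterate-stable (suc n) r = contr n (iterate n) (iterate (n + r)) (iterate-stable n r)

  fixedPoint : Series
  fixedPoint m j = iterate (suc m) m j

  fixedPoint≈iterate : ∀ n → fixedPoint ≈[< n ] iterate n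
  fixedPoint≈iterate n m j m<n with m≤n⇒∃[o]m+o≡n m<n
  ... | r , m+r≡n = subst (λ k → iterate (suc m) m j ≡ iterate k m j) m+r≡n (iterate-stable (suc m) r m j ≤-refl)

  fixedPoint-isFixed : Φ fixedPoint ≋ fixedPoint
  fixedPoint-isFixed m j = contr m fixedPoint (iterate m) (fixedPoint≈iterate m) m j ≤-refl

≋Z⊛g⊛h⇒≋𝟘 : ∀ g h → h ≋ Z ⊛ (g ⊛ h) → h ≋ 𝟘
≋Z⊛g⊛h⇒≋𝟘 g h h≋zgh = contractive-fixedPoint-unique Φ contr h 𝟘 (≋-sym h≋zgh)
  (solve 2 (λ z g → z :* (g :* con (+ 0)) := con (+ 0)) (λ _ _ → refl) Z g)
  where
  Φ : Series → Series
  Φ x = Z ⊛ (g ⊛ x)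
  contr : Contractive Φ
  contr n f f′ f≈f′ = Z⊛-≈[<] (≈[<]-⊛ (≈[<]-refl {f = g}) f≈f′)

unit-cancel : ∀ g f → (𝟙 ⊕ Z ⊛ g) ⊛ f ≋ 𝟘 → f ≋ 𝟘
unit-cancel g f uf≋0 = ≋Z⊛g⊛h⇒≋𝟘 (⊖ g) f (begin
  f                                  ≈⟨ solve 3 (λ z g f → f := z :* (:- g :* f) :+ (con (+ 1) :+ z :* g) :* f) (λ _ _ → refl) Z g f ⟩
  Z ⊛ (⊖ g ⊛ f) ⊕ (𝟙 ⊕ Z ⊛ g) ⊛ f   ≈⟨ ⊕-congˡ {Z ⊛ (⊖ g ⊛ f)} uf≋0 ⟩
  Z ⊛ (⊖ g ⊛ f) ⊕ 𝟘                 ≈⟨ solve 3 (λ z g f → z :* (:- g :* f) :+ con (+ 0) := z :* (:- g :* f)) (λ _ _ → refl) Z g f ⟩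
  Z ⊛ (⊖ g ⊛ f)                     ∎)
  where open ≋-Reasoning

≈[<]-∷ : ∀ {k n f g} (ρ : Vec Series k) → f ≈[< n ] g → ∀ i → lookup (f ∷ ρ) i ≈[< n ] lookup (g ∷ ρ) i
≈[<]-∷ ρ f≈g zero    = f≈g
≈[<]-∷ ρ f≈g (suc i) = ≈[<]-refl

≋-∷ : ∀ {k f g} (ρ : Vec Series k) → f ≋ g → ∀ i → lookup (f ∷ ρ) i ≋ lookup (g ∷ ρ) i
≋-∷ ρ f≋g zero    = f≋g
≋-∷ ρ f≋g (suc i) = ≋-refl

-- Even series

halve : Series → Series
halve f n j = f (n + n) j

Even : Series → Set
Even f = ∀ n j → f (suc (n + n)) j ≡ + 0

sumTo-even : ∀ n h → (∀ i → h (suc (i + i)) ≡ + 0) → sumTo (n + n) h ≡ sumTo n (λ i → h (i + i))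
sumTo-even zero    h h-odd≡0 = refl
sumTo-even (suc n) h h-odd≡0 = begin
  sumTo (suc n + suc n) h                                               ≡⟨ cong (λ m → sumTo (suc m) h) (+-suc n n) ⟩
  sumTo (n + n) h ℤ.+ h (suc (n + n)) ℤ.+ h (suc (suc (n + n)))         ≡⟨ cong₂ (λ x y → x ℤ.+ y ℤ.+ h (suc (suc (n + n))))
                                                                                   (sumTo-even n h h-odd≡0) (h-odd≡0 n) ⟩
  sumTo n (λ i → h (i + i)) ℤ.+ + 0 ℤ.+ h (suc (suc (n + n)))           ≡⟨ cong₂ ℤ._+_ (ℤₚ.+-identityʳ (sumTo n (λ i → h (i + i)))) (cong h (cong suc (sym (+-suc n n)))) ⟩
  sumTo (suc n) (λ i → h (i + i))                                       ∎
  where open ≡-Reasoning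

∸-double : ∀ n p → p ≤ n → (n + n) ∸ (p + p) ≡ (n ∸ p) + (n ∸ p)
∸-double n       zero    _         = refl
∸-double (suc n) (suc p) (s≤s p≤n) = trans (cong₂ _∸_ (+-suc n n) (+-suc p p)) (∸-double n p p≤n)

halve-⊛ : ∀ f g → Even f → halve (f ⊛ g) ≋ halve f ⊛ halve g
halve-⊛ f g f-even n j = trans
  (sumTo-even n _ (λ i → sumTo-zeros j _ (λ q → cong (ℤ._* g (n + n ∸ suc (i + i)) (j ∸ q)) (f-even i q))))
  (sumTo-cong≤ n (λ p p≤n → sumTo-cong≤ j (λ q _ → cong (λ m → f (p + p) q ℤ.* g m (j ∸ q)) (∸-double n p p≤n))))

halve-cong : ∀ {f g} → f ≋ g → halve f ≋ halve g
halve-cong f≋g n j = f≋g (n + n) j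

cst-even : ∀ c → Even (cst c)
cst-even c n j = refl

halve-cst : ∀ c → halve (cst c) ≋ cst c
halve-cst c zero    j = refl
halve-cst c (suc n) j = refl

halve-T : halve T ≋ T
halve-T zero    j = refl
halve-T (suc n) j = refl

Z²-suc² : ∀ m j → (Z ^ₛ 2) (suc (suc m)) j ≡ 𝟙 m j
Z²-suc² m j = trans (Z⊛-suc (Z ⊛ 𝟙) (suc m) j) (Z⊛-suc 𝟙 m j)

Z²-even : Even (Z ^ₛ 2)
Z²-even zero    j = trans (Z⊛-suc (Z ⊛ 𝟙) 0 j) (Z⊛-zero 𝟙 j)
Z²-even (suc n) j = trans (Z²-suc² (n + suc n) j) (cong (λ m → 𝟙 m j) (+-suc n n))

halve-Z² : halve (Z ^ₛ 2) ≋ Z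
halve-Z² zero          j       = Z⊛-zero (Z ⊛ 𝟙) j
halve-Z² (suc zero)    zero    = Z²-suc² 0 0
halve-Z² (suc zero)    (suc j) = Z²-suc² 0 (suc j)
halve-Z² (suc (suc m)) j       = trans (Z²-suc² (m + suc (suc m)) j) (cong (λ x → 𝟙 x j) (+-suc m (suc m)))

-- The branch u₁

Z²⊛-zero : ∀ f j → (Z ^ₛ 2 ⊛ f) 0 j ≡ + 0
Z²⊛-zero f j = trans (Z²⊛≋Z⊛Z⊛ f 0 j) (Z⊛-zero (Z ⊛ f) j)

Z²⊛-one : ∀ f j → (Z ^ₛ 2 ⊛ f) 1 j ≡ + 0
Z²⊛-one f j = trans (Z²⊛≋Z⊛Z⊛ f 1 j) (trans (Z⊛-suc (Z ⊛ f) 0 j) (Z⊛-zero f j))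

Z²⊛-suc² : ∀ f n j → (Z ^ₛ 2 ⊛ f) (suc (suc n)) j ≡ f n j
Z²⊛-suc² f n j = trans (Z²⊛≋Z⊛Z⊛ f (suc (suc n)) j) (trans (Z⊛-suc (Z ⊛ f) (suc n) j) (Z⊛-suc f n j))

-- cubicV (1 + z² ε) / z², the equation for u₁ = 1/z + z ε
reducedCubic : Series → Series
reducedCubic ε = ε ⊕ 𝟙 ⊝ Z ^ₛ 2 ⊕ cst (+ 2) ⊛ Z ^ₛ 2 ⊛ ε ^ₛ 2 ⊕ Z ^ₛ 4 ⊛ (ε ^ₛ 3 ⊝ ε ^ₛ 2 ⊝ ε ⊝ 𝟙 ⊕ T)

cubicVᴱ reducedCubicᴱ : ∀ {k} (z t v : Expr ℤ k) → Expr ℤ k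
cubicVᴱ z t v = con (+ 2) :* z :^ 2 :* v :- z :^ 6 :- v :^ 2 :+ z :^ 6 :* t :- z :^ 4 :* v :+ v :^ 3 :- z :^ 2 :* v :^ 2
reducedCubicᴱ z t ε =
  ε :+ con (+ 1) :- z :^ 2 :+ con (+ 2) :* z :^ 2 :* ε :^ 2 :+ z :^ 4 :* (ε :^ 3 :- ε :^ 2 :- ε :- con (+ 1) :+ t)

cubicV-cong : ∀ {f g} → f ≋ g → cubicV f ≋ cubicV g
cubicV-cong {f} {g} f≋g = polynomial-cong (cubicVᴱ (Ι (suc zero)) (Ι (suc (suc zero))) (Ι zero)) {f ∷ Z ∷ T ∷ []} {g ∷ Z ∷ T ∷ []} (≋-∷ (Z ∷ T ∷ []) f≋g)

cubicV-1+Z²⊛ : ∀ ε → cubicV (𝟙 ⊕ Z ^ₛ 2 ⊛ ε) ≋ Z ^ₛ 2 ⊛ reducedCubic ε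
cubicV-1+Z²⊛ ε = solve 3 (λ z t ε → cubicVᴱ z t (con (+ 1) :+ z :^ 2 :* ε) := z :^ 2 :* reducedCubicᴱ z t ε) (λ _ _ → refl) Z T ε

shift² : Series → Series
shift² v n = v (suc (suc n))

IsU1⇒≋1+Z²⊛ : ∀ {v} → IsU1 v → v ≋ 𝟙 ⊕ Z ^ₛ 2 ⊛ shift² v
IsU1⇒≋1+Z²⊛ {v} (_ , v₀₀≡1 , v₀₊≡0 , v₁≡0) = go
  where
  ε = shift² v
  go : v ≋ 𝟙 ⊕ Z ^ₛ 2 ⊛ ε
  go zero          zero    = trans v₀₀≡1 (sym (cong (λ x → + 1 ℤ.+ x) (Z²⊛-zero ε 0)))
  go zero          (suc j) = trans (v₀₊≡0 j) (sym (cong (λ x → + 0 ℤ.+ x) (Z²⊛-zero ε (suc j))))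
  go (suc zero)    j       = trans (v₁≡0 j) (sym (cong (λ x → + 0 ℤ.+ x) (Z²⊛-one ε j)))
  go (suc (suc n)) j       = sym (trans (ℤₚ.+-identityˡ _) (Z²⊛-suc² ε n j))

IsU1⇒reducedCubic≋𝟘 : ∀ {v} → IsU1 v → reducedCubic (shift² v) ≋ 𝟘
IsU1⇒reducedCubic≋𝟘 {v} u@(cubic≋0 , _) = Z²⊛-cancel (reducedCubic ε) (begin
  Z ^ₛ 2 ⊛ reducedCubic ε     ≈⟨ ≋-sym (cubicV-1+Z²⊛ ε) ⟩
  cubicV (𝟙 ⊕ Z ^ₛ 2 ⊛ ε)    ≈⟨ cubicV-cong {𝟙 ⊕ Z ^ₛ 2 ⊛ ε} {v} (≋-sym (IsU1⇒≋1+Z²⊛ u)) ⟩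
  cubicV v                    ≈⟨ cubic≋0 ⟩
  𝟘                           ∎)
  where
  open ≋-Reasoning
  ε = shift² v

reducedCubic≋𝟘⇒IsU1 : ∀ {ε} → reducedCubic ε ≋ 𝟘 → IsU1 (𝟙 ⊕ Z ^ₛ 2 ⊛ ε)
reducedCubic≋𝟘⇒IsU1 {ε} Qε≋0 =
    ≋-trans (cubicV-1+Z²⊛ ε) (≋-trans (⊛-congˡ {Z ^ₛ 2} Qε≋0) (solve 1 (λ z → z :^ 2 :* con (+ 0) := con (+ 0)) (λ _ _ → refl) Z))
  , cong (λ x → + 1 ℤ.+ x) (Z²⊛-zero ε 0)
  , (λ j → cong (λ x → + 0 ℤ.+ x) (Z²⊛-zero ε (suc j)))
  , (λ j → cong (λ x → 𝟙 1 j ℤ.+ x) (Z²⊛-one ε j))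

-- The roots of reducedCubic are the fixed points of Ψ, which only sees ε through multiples of z.
module ReducedCubicRoot where

  Ψ : Series → Series
  Ψ ε = ⊖ 𝟙 ⊕ Z ⊛ (Z ⊝ cst (+ 2) ⊛ Z ⊛ ε ^ₛ 2 ⊝ Z ^ₛ 3 ⊛ (ε ^ₛ 3 ⊝ ε ^ₛ 2 ⊝ ε ⊝ 𝟙 ⊕ T))

  Ψ-contractive : Contractive Ψ
  Ψ-contractive n f g f≈g = ≈[<]-⊕ (≈[<]-refl {f = ⊖ 𝟙}) (Z⊛-≈[<] (polynomial-≈[<]
    (let ε = Ι zero ; z = Ι (suc zero) ; t = Ι (suc (suc zero)) in
     z :- con (+ 2) :* z :* ε :^ 2 :- z :^ 3 :* (ε :^ 3 :- ε :^ 2 :- ε :- con (+ 1) :+ t))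
    {f ∷ Z ∷ T ∷ []} {g ∷ Z ∷ T ∷ []} (≈[<]-∷ (Z ∷ T ∷ []) f≈g)))

  reducedCubic≋id⊝Ψ : ∀ ε → reducedCubic ε ≋ ε ⊝ Ψ ε
  reducedCubic≋id⊝Ψ ε = solve 3 (λ z t ε → reducedCubicᴱ z t ε
    := ε :- (:- con (+ 1) :+ z :* (z :- con (+ 2) :* z :* ε :^ 2 :- z :^ 3 :* (ε :^ 3 :- ε :^ 2 :- ε :- con (+ 1) :+ t))))
    (λ _ _ → refl) Z T ε

  open FixedPoint Ψ Ψ-contractive using (fixedPoint; fixedPoint-isFixed)

  ε₀ : Series
  ε₀ = fixedPoint

  reducedCubic-ε₀ : reducedCubic ε₀ ≋ 𝟘
  reducedCubic-ε₀ = begin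
    reducedCubic ε₀  ≈⟨ reducedCubic≋id⊝Ψ ε₀ ⟩
    ε₀ ⊝ Ψ ε₀        ≈⟨ ⊕-congˡ {ε₀} (⊖-cong fixedPoint-isFixed) ⟩
    ε₀ ⊝ ε₀          ≈⟨ solve 1 (λ ε → ε :- ε := con (+ 0)) (λ _ _ → refl) ε₀ ⟩
    𝟘                ∎
    where open ≋-Reasoning

open ReducedCubicRoot using (ε₀; reducedCubic-ε₀)

-- Counting paths

private variable I J : Set

sum-map-zero : ∀ (xs : List I) → sum (map (λ _ → 0) xs) ≡ 0
sum-map-zero []       = refl
sum-map-zero (x ∷ xs) = sum-map-zero xs

sum-map-cong : ∀ {f g : I → ℕ} xs → (∀ x → f x ≡ g x) → sum (map f xs) ≡ sum (map g xs)
sum-map-cong xs f≡g = cong sum (map-cong f≡g xs)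

sum-map-All-zero : ∀ {f : I → ℕ} {xs} → All (λ x → f x ≡ 0) xs → sum (map f xs) ≡ 0
sum-map-All-zero []             = refl
sum-map-All-zero (fx≡0 ∷ fxs≡0) = cong₂ _+_ fx≡0 (sum-map-All-zero fxs≡0)

sum-map-+ : ∀ (f g : I → ℕ) xs → sum (map (λ x → f x + g x) xs) ≡ sum (map f xs) + sum (map g xs)
sum-map-+ f g []       = refl
sum-map-+ f g (x ∷ xs) = trans (cong (λ s → f x + g x + s) (sum-map-+ f g xs)) (interchange (f x) (g x) _ _)

sum-map-concatMap : ∀ (f : J → ℕ) (g : I → List J) xs →
                    sum (map f (concatMap g xs)) ≡ sum (map (λ x → sum (map f (g x))) xs)
sum-map-concatMap f g []       = refl
sum-map-concatMap f g (x ∷ xs) = begin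
  sum (map f (g x ++ concatMap g xs))                     ≡⟨ cong sum (map-++ f (g x) _) ⟩
  sum (map f (g x) ++ map f (concatMap g xs))             ≡⟨ sum-++ (map f (g x)) _ ⟩
  sum (map f (g x)) + sum (map f (concatMap g xs))        ≡⟨ cong (λ s → sum (map f (g x)) + s) (sum-map-concatMap f g xs) ⟩
  sum (map f (g x)) + sum (map (λ x → sum (map f (g x))) xs) ∎
  where open ≡-Reasoning

sum-map-swap : ∀ (F : I → J → ℕ) xs ys →
               sum (map (λ x → sum (map (F x) ys)) xs) ≡ sum (map (λ y → sum (map (λ x → F x y) xs)) ys)
sum-map-swap F []       ys = sym (sum-map-zero ys)
sum-map-swap F (x ∷ xs) ys = trans (cong (λ s → sum (map (F x) ys) + s) (sum-map-swap F xs ys))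
                                   (sym (sum-map-+ (F x) _ ys))

data Tail : Set where
  none endU endUD endD endL : Tail

-- The last steps as far as UL, LU and UDL are concerned; endD is a D not preceded by U.
suffix : Tail → List Step
suffix none  = []
suffix endU  = U ∷ []
suffix endUD = U ∷ D ∷ []
suffix endD  = D ∷ []
suffix endL  = L ∷ []

data State : Set where
  dead : State
  at   : (level udl : ℕ) → Tail → State

-- Matching on the step first makes D and L from level zero reduce for every tail.
move : Step → State → State
move _ dead                 = dead
move U (at h m endL)        = dead
move U (at h m _)           = at (suc h) m endU
move D (at zero m _)        = dead
move D (at (suc h) m endU)  = at h m endUD
move D (at (suc h) m _)     = at h m endD
move L (at zero m _)        = dead
move L (at (suc h) m endU)  = dead
move L (at (suc h) m endUD) = at h (suc m) endL
move L (at (suc h) m _)     = at h m endL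

step : State → Step → State
step s x = move x s

runFrom : State → List Step → State
runFrom = foldl step

run : List Step → State
run = runFrom (at 0 0 none)

endsIn : ℕ → ℕ → State → Bool
endsIn k j dead       = false
endsIn k j (at h m c) = eqℕ h k ∧ eqℕ m j

runFrom-dead : ∀ w → runFrom dead w ≡ dead
runFrom-dead []      = refl
runFrom-dead (x ∷ w) = runFrom-dead w

endsIn-dead : ∀ k j w → endsIn k j (runFrom dead w) ≡ false
endsIn-dead k j w = cong (endsIn k j) (runFrom-dead w)

endsAt-[] : ∀ h k → endsAt h k [] ≡ eqℕ h k
endsAt-[] zero    zero    = refl
endsAt-[] zero    (suc k) = refl
endsAt-[] (suc h) zero    = refl
endsAt-[] (suc h) (suc k) = endsAt-[] h k

endsIn-[] : ∀ h m k j → eqℕ h k ∧ eqℕ m j ≡ endsAt h k [] ∧ eqℕ (m + 0) j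
endsIn-[] h m k j = cong₂ _∧_ (sym (endsAt-[] h k)) (cong (λ x → eqℕ x j) (sym (+-identityʳ m)))

endsAt-U : ∀ h k w → endsAt h k (U ∷ w) ≡ endsAt (suc h) k w
endsAt-U zero    zero    w = refl
endsAt-U zero    (suc k) w = refl
endsAt-U (suc h) zero    w = refl
endsAt-U (suc h) (suc k) w = refl

endsAt-D-zero : ∀ k w → endsAt 0 k (D ∷ w) ≡ false
endsAt-D-zero zero    w = refl
endsAt-D-zero (suc k) w = refl

endsAt-L-zero : ∀ k w → endsAt 0 k (L ∷ w) ≡ false
endsAt-L-zero zero    w = refl
endsAt-L-zero (suc k) w = refl

endsAt-D-suc : ∀ h k w → endsAt (suc h) k (D ∷ w) ≡ endsAt h k w
endsAt-D-suc h zero    w = refl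
endsAt-D-suc h (suc k) w = refl

endsAt-L-suc : ∀ h k w → endsAt (suc h) k (L ∷ w) ≡ endsAt h k w
endsAt-L-suc h zero    w = refl
endsAt-L-suc h (suc k) w = refl

endsIn-runFrom : ∀ w h m c k j → endsIn k j (runFrom (at h m c) w) ≡
  noOverlap (suffix c ++ w) ∧ endsAt h k w ∧ eqℕ (m + countUDL (suffix c ++ w)) j
endsIn-runFrom [] h m none  k j = endsIn-[] h m k j
endsIn-runFrom [] h m endU  k j = endsIn-[] h m k j
endsIn-runFrom [] h m endUD k j = endsIn-[] h m k j
endsIn-runFrom [] h m endD  k j = endsIn-[] h m k j
endsIn-runFrom [] h m endL  k j = endsIn-[] h m k j
endsIn-runFrom (U ∷ w) h m none  k j rewrite endsAt-U h k w = endsIn-runFrom w (suc h) m endU k j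
endsIn-runFrom (U ∷ w) h m endU  k j rewrite endsAt-U h k w = endsIn-runFrom w (suc h) m endU k j
endsIn-runFrom (U ∷ w) h m endUD k j rewrite endsAt-U h k w = endsIn-runFrom w (suc h) m endU k j
endsIn-runFrom (U ∷ w) h m endD  k j rewrite endsAt-U h k w = endsIn-runFrom w (suc h) m endU k j
endsIn-runFrom (U ∷ w) h m endL  k j = endsIn-dead k j w
endsIn-runFrom (D ∷ w) zero    m c     k j rewrite endsAt-D-zero k w = trans (endsIn-dead k j w) (sym (∧-zeroʳ _))
endsIn-runFrom (D ∷ w) (suc h) m none  k j rewrite endsAt-D-suc h k w = endsIn-runFrom w h m endD k j
endsIn-runFrom (D ∷ w) (suc h) m endU  k j rewrite endsAt-D-suc h k w = endsIn-runFrom w h m endUD k j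
endsIn-runFrom (D ∷ w) (suc h) m endUD k j rewrite endsAt-D-suc h k w = endsIn-runFrom w h m endD k j
endsIn-runFrom (D ∷ w) (suc h) m endD  k j rewrite endsAt-D-suc h k w = endsIn-runFrom w h m endD k j
endsIn-runFrom (D ∷ w) (suc h) m endL  k j rewrite endsAt-D-suc h k w = endsIn-runFrom w h m endD k j
endsIn-runFrom (L ∷ w) zero    m c     k j rewrite endsAt-L-zero k w = trans (endsIn-dead k j w) (sym (∧-zeroʳ _))
endsIn-runFrom (L ∷ w) (suc h) m none  k j rewrite endsAt-L-suc h k w = endsIn-runFrom w h m endL k j
endsIn-runFrom (L ∷ w) (suc h) m endU  k j = endsIn-dead k j w
endsIn-runFrom (L ∷ w) (suc h) m endUD k j rewrite endsAt-L-suc h k w =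
  trans (endsIn-runFrom w h (suc m) endL k j) (cong (λ x → noOverlap (L ∷ w) ∧ endsAt h k w ∧ eqℕ x j) (sym (+-suc m _)))
endsIn-runFrom (L ∷ w) (suc h) m endD  k j rewrite endsAt-L-suc h k w = endsIn-runFrom w h m endL k j
endsIn-runFrom (L ∷ w) (suc h) m endL  k j rewrite endsAt-L-suc h k w = endsIn-runFrom w h m endL k j

good≡endsIn-run : ∀ j k w → good j k w ≡ endsIn k j (run w)
good≡endsIn-run j k w = sym (endsIn-runFrom w 0 0 none k j)

fromBool : Bool → ℕ
fromBool true  = 1
fromBool false = 0

eqTail : Tail → Tail → Bool
eqTail none  none  = true
eqTail endU  endU  = true
eqTail endUD endUD = true
eqTail endD  endD  = true
eqTail endL  endL  = true
eqTail _     _     = false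


steps : List Step
steps = U ∷ D ∷ L ∷ []

tails : List Tail
tails = none ∷ endU ∷ endUD ∷ endD ∷ endL ∷ []

record Position : Set where
  constructor ⟨_,_,_⟩
  field
    tail  : Tail
    udl   : ℕ
    level : ℕ

open Position

indicator : Position → State → ℕ
indicator p             dead        = 0
indicator ⟨ c , j , k ⟩ (at h m c′) = fromBool (eqTail c′ c ∧ eqℕ h k ∧ eqℕ m j)

predecessors : Position → List Position
predecessors ⟨ none  , j     , k     ⟩ = []
predecessors ⟨ endU  , j     , zero  ⟩ = []
predecessors ⟨ endU  , j     , suc k ⟩ = ⟨ none , j , k ⟩ ∷ ⟨ endU , j , k ⟩ ∷ ⟨ endUD , j , k ⟩ ∷ ⟨ endD , j , k ⟩ ∷ []
predecessors ⟨ endUD , j     , k     ⟩ = ⟨ endU , j , suc k ⟩ ∷ []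
predecessors ⟨ endD  , j     , k     ⟩ = ⟨ none , j , suc k ⟩ ∷ ⟨ endUD , j , suc k ⟩ ∷ ⟨ endD , j , suc k ⟩ ∷ ⟨ endL , j , suc k ⟩ ∷ []
predecessors ⟨ endL  , zero  , k     ⟩ = ⟨ none , 0 , suc k ⟩ ∷ ⟨ endD , 0 , suc k ⟩ ∷ ⟨ endL , 0 , suc k ⟩ ∷ []
predecessors ⟨ endL  , suc j , k     ⟩ = ⟨ none , suc j , suc k ⟩ ∷ ⟨ endUD , j , suc k ⟩ ∷ ⟨ endD , suc j , suc k ⟩ ∷ ⟨ endL , suc j , suc k ⟩ ∷ []

incoming : Position → State → ℕ
incoming p s = sum (map (λ x → indicator p (step s x)) steps)

fromPredecessors : Position → State → ℕ
fromPredecessors p s = sum (map (λ q → indicator q s) (predecessors p))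

incoming-none : ∀ j k s → incoming ⟨ none , j , k ⟩ s ≡ fromPredecessors ⟨ none , j , k ⟩ s
incoming-none j k dead                 = refl
incoming-none j k (at zero    m none)  = refl
incoming-none j k (at zero    m endU)  = refl
incoming-none j k (at zero    m endUD) = refl
incoming-none j k (at zero    m endD)  = refl
incoming-none j k (at zero    m endL)  = refl
incoming-none j k (at (suc h) m none)  = refl
incoming-none j k (at (suc h) m endU)  = refl
incoming-none j k (at (suc h) m endUD) = refl
incoming-none j k (at (suc h) m endD)  = refl
incoming-none j k (at (suc h) m endL)  = refl

incoming-endU-zero : ∀ j s → incoming ⟨ endU , j , zero ⟩ s ≡ fromPredecessors ⟨ endU , j , zero ⟩ s
incoming-endU-zero j dead                 = refl
incoming-endU-zero j (at zero    m none)  = refl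
incoming-endU-zero j (at zero    m endU)  = refl
incoming-endU-zero j (at zero    m endUD) = refl
incoming-endU-zero j (at zero    m endD)  = refl
incoming-endU-zero j (at zero    m endL)  = refl
incoming-endU-zero j (at (suc h) m none)  = refl
incoming-endU-zero j (at (suc h) m endU)  = refl
incoming-endU-zero j (at (suc h) m endUD) = refl
incoming-endU-zero j (at (suc h) m endD)  = refl
incoming-endU-zero j (at (suc h) m endL)  = refl

incoming-endU-suc : ∀ j k s → incoming ⟨ endU , j , suc k ⟩ s ≡ fromPredecessors ⟨ endU , j , suc k ⟩ s
incoming-endU-suc j k dead                 = refl
incoming-endU-suc j k (at zero    m none)  = refl
incoming-endU-suc j k (at zero    m endU)  = refl
incoming-endU-suc j k (at zero    m endUD) = refl
incoming-endU-suc j k (at zero    m endD)  = refl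
incoming-endU-suc j k (at zero    m endL)  = refl
incoming-endU-suc j k (at (suc h) m none)  = refl
incoming-endU-suc j k (at (suc h) m endU)  = refl
incoming-endU-suc j k (at (suc h) m endUD) = refl
incoming-endU-suc j k (at (suc h) m endD)  = refl
incoming-endU-suc j k (at (suc h) m endL)  = refl

incoming-endUD : ∀ j k s → incoming ⟨ endUD , j , k ⟩ s ≡ fromPredecessors ⟨ endUD , j , k ⟩ s
incoming-endUD j k dead                 = refl
incoming-endUD j k (at zero    m none)  = refl
incoming-endUD j k (at zero    m endU)  = refl
incoming-endUD j k (at zero    m endUD) = refl
incoming-endUD j k (at zero    m endD)  = refl
incoming-endUD j k (at zero    m endL)  = refl
incoming-endUD j k (at (suc h) m none)  = refl
incoming-endUD j k (at (suc h) m endU)  = refl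
incoming-endUD j k (at (suc h) m endUD) = refl
incoming-endUD j k (at (suc h) m endD)  = refl
incoming-endUD j k (at (suc h) m endL)  = refl

incoming-endD : ∀ j k s → incoming ⟨ endD , j , k ⟩ s ≡ fromPredecessors ⟨ endD , j , k ⟩ s
incoming-endD j k dead                 = refl
incoming-endD j k (at zero    m none)  = refl
incoming-endD j k (at zero    m endU)  = refl
incoming-endD j k (at zero    m endUD) = refl
incoming-endD j k (at zero    m endD)  = refl
incoming-endD j k (at zero    m endL)  = refl
incoming-endD j k (at (suc h) m none)  = refl
incoming-endD j k (at (suc h) m endU)  = refl
incoming-endD j k (at (suc h) m endUD) = refl
incoming-endD j k (at (suc h) m endD)  = refl
incoming-endD j k (at (suc h) m endL)  = refl

incoming-endL-zero : ∀ k s → incoming ⟨ endL , zero , k ⟩ s ≡ fromPredecessors ⟨ endL , zero , k ⟩ s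
incoming-endL-zero k dead                 = refl
incoming-endL-zero k (at zero    m none)  = refl
incoming-endL-zero k (at zero    m endU)  = refl
incoming-endL-zero k (at zero    m endUD) = refl
incoming-endL-zero k (at zero    m endD)  = refl
incoming-endL-zero k (at zero    m endL)  = refl
incoming-endL-zero k (at (suc h) m none)  = refl
incoming-endL-zero k (at (suc h) m endU)  = refl
-- this L completes a UDL, so it cannot end at udl 0
incoming-endL-zero k (at (suc h) m endUD) = cong (λ b → fromBool b + 0) (∧-zeroʳ (eqℕ h k))
incoming-endL-zero k (at (suc h) m endD)  = refl
incoming-endL-zero k (at (suc h) m endL)  = refl

incoming-endL-suc : ∀ j k s → incoming ⟨ endL , suc j , k ⟩ s ≡ fromPredecessors ⟨ endL , suc j , k ⟩ s
incoming-endL-suc j k dead                 = refl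
incoming-endL-suc j k (at zero    m none)  = refl
incoming-endL-suc j k (at zero    m endU)  = refl
incoming-endL-suc j k (at zero    m endUD) = refl
incoming-endL-suc j k (at zero    m endD)  = refl
incoming-endL-suc j k (at zero    m endL)  = refl
incoming-endL-suc j k (at (suc h) m none)  = refl
incoming-endL-suc j k (at (suc h) m endU)  = refl
incoming-endL-suc j k (at (suc h) m endUD) = refl
incoming-endL-suc j k (at (suc h) m endD)  = refl
incoming-endL-suc j k (at (suc h) m endL)  = refl

incoming≡fromPredecessors : ∀ p s → incoming p s ≡ fromPredecessors p s
incoming≡fromPredecessors ⟨ none  , j     , k     ⟩ = incoming-none j k
incoming≡fromPredecessors ⟨ endU  , j     , zero  ⟩ = incoming-endU-zero j
incoming≡fromPredecessors ⟨ endU  , j     , suc k ⟩ = incoming-endU-suc j k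
incoming≡fromPredecessors ⟨ endUD , j     , k     ⟩ = incoming-endUD j k
incoming≡fromPredecessors ⟨ endD  , j     , k     ⟩ = incoming-endD j k
incoming≡fromPredecessors ⟨ endL  , zero  , k     ⟩ = incoming-endL-zero k
incoming≡fromPredecessors ⟨ endL  , suc j , k     ⟩ = incoming-endL-suc j k

sum-map-words-suc : ∀ n F → sum (map F (words (suc n))) ≡ sum (map (λ w → sum (map (λ x → F (x ∷ w)) steps)) (words n))
sum-map-words-suc n F = sum-map-concatMap F _ (words n)

-- words are generated by prepending steps; the counting needs appending.
sum-map-words-snoc : ∀ n F → sum (map F (words (suc n))) ≡ sum (map (λ w → sum (map (λ x → F (w ∷ʳ x)) steps)) (words n))
sum-map-words-snoc zero    F = sym (+-identityʳ _)
sum-map-words-snoc (suc n) F = begin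
  sum (map F (words (suc (suc n))))
    ≡⟨ sum-map-words-suc (suc n) F ⟩
  sum (map (λ w → sum (map (λ x → F (x ∷ w)) steps)) (words (suc n)))
    ≡⟨ sum-map-words-snoc n _ ⟩
  sum (map (λ w → sum (map (λ y → sum (map (λ x → F (x ∷ w ∷ʳ y)) steps)) steps)) (words n))
    ≡⟨ sum-map-cong (words n) (λ w → sum-map-swap (λ y x → F (x ∷ w ∷ʳ y)) steps steps) ⟩
  sum (map (λ w → sum (map (λ x → sum (map (λ y → F (x ∷ w ∷ʳ y)) steps)) steps)) (words n))
    ≡⟨ sym (sum-map-words-suc n _) ⟩
  sum (map (λ w → sum (map (λ y → F (w ∷ʳ y)) steps)) (words (suc n))) ∎
  where open ≡-Reasoning

paths : ℕ → Position → ℕ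
paths n p = sum (map (λ w → indicator p (run w)) (words n))

paths-suc : ∀ n p → paths (suc n) p ≡ sum (map (paths n) (predecessors p))
paths-suc n p = begin
  sum (map (λ w → indicator p (run w)) (words (suc n)))
    ≡⟨ sum-map-words-snoc n _ ⟩
  sum (map (λ w → sum (map (λ x → indicator p (run (w ∷ʳ x))) steps)) (words n))
    ≡⟨ sum-map-cong (words n) (λ w → sum-map-cong steps (λ x → cong (indicator p) (foldl-∷ʳ step (at 0 0 none) x w))) ⟩
  sum (map (λ w → incoming p (run w)) (words n))
    ≡⟨ sum-map-cong (words n) (λ w → incoming≡fromPredecessors p (run w)) ⟩
  sum (map (λ w → fromPredecessors p (run w)) (words n))
    ≡⟨ sum-map-swap (λ w q → indicator q (run w)) (words n) (predecessors p) ⟩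
  sum (map (paths n) (predecessors p)) ∎
  where open ≡-Reasoning

countTrue≡sum-map : ∀ P xs → countTrue P xs ≡ sum (map (λ x → fromBool (P x)) xs)
countTrue≡sum-map P []       = refl
countTrue≡sum-map P (x ∷ xs) with P x
... | true  = cong suc (countTrue≡sum-map P xs)
... | false = countTrue≡sum-map P xs

endsIn≡sum-indicator : ∀ k j s → fromBool (endsIn k j s) ≡ sum (map (λ c → indicator ⟨ c , j , k ⟩ s) tails)
endsIn≡sum-indicator k j dead           = refl
endsIn≡sum-indicator k j (at h m none)  = sym (+-identityʳ _)
endsIn≡sum-indicator k j (at h m endU)  = sym (+-identityʳ _)
endsIn≡sum-indicator k j (at h m endUD) = sym (+-identityʳ _)
endsIn≡sum-indicator k j (at h m endD)  = sym (+-identityʳ _)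
endsIn≡sum-indicator k j (at h m endL)  = sym (+-identityʳ _)

a≡sum-paths : ∀ n j k → a n j k ≡ sum (map (λ c → paths n ⟨ c , j , k ⟩) tails)
a≡sum-paths n j k = begin
  countTrue (good j k) (words n)                                    ≡⟨ countTrue≡sum-map (good j k) (words n) ⟩
  sum (map (λ w → fromBool (good j k w)) (words n))                 ≡⟨ sum-map-cong (words n) (λ w →
                                                                         trans (cong fromBool (good≡endsIn-run j k w)) (endsIn≡sum-indicator k j (run w))) ⟩
  sum (map (λ w → sum (map (λ c → indicator ⟨ c , j , k ⟩ (run w)) tails)) (words n))
                                                                    ≡⟨ sum-map-swap (λ w c → indicator ⟨ c , j , k ⟩ (run w)) (words n) tails ⟩
  sum (map (λ c → paths n ⟨ c , j , k ⟩) tails)                     ∎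
  where open ≡-Reasoning

predecessors-udl : ∀ p → All (λ q → udl p ≤ suc (udl q)) (predecessors p)
predecessors-udl ⟨ none  , j     , k     ⟩ = []
predecessors-udl ⟨ endU  , j     , zero  ⟩ = []
predecessors-udl ⟨ endU  , j     , suc k ⟩ = n≤1+n j ∷ n≤1+n j ∷ n≤1+n j ∷ n≤1+n j ∷ []
predecessors-udl ⟨ endUD , j     , k     ⟩ = n≤1+n j ∷ []
predecessors-udl ⟨ endD  , j     , k     ⟩ = n≤1+n j ∷ n≤1+n j ∷ n≤1+n j ∷ n≤1+n j ∷ []
predecessors-udl ⟨ endL  , zero  , k     ⟩ = z≤n ∷ z≤n ∷ z≤n ∷ []
predecessors-udl ⟨ endL  , suc j , k     ⟩ = n≤1+n (suc j) ∷ ≤-refl ∷ n≤1+n (suc j) ∷ n≤1+n (suc j) ∷ []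

paths-udl-bound : ∀ n p → n < udl p → paths n p ≡ 0
paths-udl-bound zero    ⟨ c , suc j , k ⟩ _   =
  cong (λ b → fromBool b + 0) (trans (cong (eqTail none c ∧_) (∧-zeroʳ (eqℕ 0 k))) (∧-zeroʳ (eqTail none c)))
paths-udl-bound (suc n) p             n<j = trans (paths-suc n p) (sum-map-All-zero
  (All.map (λ j≤ → paths-udl-bound n _ (s≤s⁻¹ (≤-trans n<j j≤))) (predecessors-udl p)))

parity-suc : ∀ n → parity (suc n) ≡ parity n ⁻¹
parity-suc n = trans (sym (⁻¹-involutive _)) (cong _⁻¹ (suc-homo-⁻¹ n))

predecessors-parity : ∀ p → All (λ q → parity (level q) ≡ parity (level p) ⁻¹) (predecessors p)
predecessors-parity ⟨ none  , j     , k     ⟩ = []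
predecessors-parity ⟨ endU  , j     , zero  ⟩ = []
predecessors-parity ⟨ endU  , j     , suc k ⟩ = k-parity ∷ k-parity ∷ k-parity ∷ k-parity ∷ []
  where k-parity = sym (suc-homo-⁻¹ k)
predecessors-parity ⟨ endUD , j     , k     ⟩ = parity-suc k ∷ []
predecessors-parity ⟨ endD  , j     , k     ⟩ = parity-suc k ∷ parity-suc k ∷ parity-suc k ∷ parity-suc k ∷ []
predecessors-parity ⟨ endL  , zero  , k     ⟩ = parity-suc k ∷ parity-suc k ∷ parity-suc k ∷ []
predecessors-parity ⟨ endL  , suc j , k     ⟩ = parity-suc k ∷ parity-suc k ∷ parity-suc k ∷ parity-suc k ∷ []

paths-parity : ∀ n p → parity n ≡ parity (level p) ⁻¹ → paths n p ≡ 0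
paths-parity zero    ⟨ c , j , zero  ⟩ ()
paths-parity zero    ⟨ c , j , suc k ⟩ _   = cong (λ b → fromBool b + 0) (∧-zeroʳ (eqTail none c))
paths-parity (suc n) p                 n-parity = trans (paths-suc n p) (sum-map-All-zero
  (All.map (λ q-parity → paths-parity n _ (trans (sym (suc-homo-⁻¹ n)) (trans (cong _⁻¹ n-parity) (cong _⁻¹ (sym q-parity)))))
           (predecessors-parity p)))

-- Generating functions by level

G : Tail → ℕ → Series
G c k n j = + paths n ⟨ c , j , k ⟩

initial : ℕ → Series
initial zero    = 𝟙
initial (suc k) = 𝟘

P Y : ℕ → Series
P k = G none k ⊕ (G endU k ⊕ (G endUD k ⊕ G endD k))
Y k = G endD k ⊕ G endL k

afterU : ℕ → Series
afterU zero    = 𝟘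
afterU (suc k) = Z ⊛ P k

-- Unlike + sum, this sum has no trailing + 0, so it reduces to the ⊕-sums above.
sumℤ : List ℕ → ℤ
sumℤ []           = + 0
sumℤ (x ∷ [])     = + x
sumℤ (x ∷ y ∷ ys) = + x ℤ.+ sumℤ (y ∷ ys)

+-sum : ∀ xs → + sum xs ≡ sumℤ xs
+-sum []           = refl
+-sum (x ∷ [])     = cong +_ (+-identityʳ x)
+-sum (x ∷ y ∷ ys) = trans (ℤₚ.pos-+ x (sum (y ∷ ys))) (cong (λ s → + x ℤ.+ s) (+-sum (y ∷ ys)))

G-suc : ∀ c k n j → G c k (suc n) j ≡ sumℤ (map (paths n) (predecessors ⟨ c , j , k ⟩))
G-suc c k n j = trans (cong +_ (paths-suc n ⟨ c , j , k ⟩)) (+-sum (map (paths n) (predecessors ⟨ c , j , k ⟩)))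

G-none : ∀ k → G none k ≋ initial k
G-none zero    zero    zero    = refl
G-none zero    zero    (suc j) = refl
G-none zero    (suc n) j       = G-suc none 0 n j
G-none (suc k) zero    zero    = refl
G-none (suc k) zero    (suc j) = refl
G-none (suc k) (suc n) j       = G-suc none (suc k) n j

G-endU : ∀ k → G endU k ≋ afterU k
G-endU zero    zero    zero    = refl
G-endU zero    zero    (suc j) = refl
G-endU zero    (suc n) j       = G-suc endU 0 n j
G-endU (suc k)                 = ≋Z⊛ {G endU (suc k)} {P k} (λ j → refl) (λ n j → G-suc endU (suc k) n j)

G-endUD : ∀ k → G endUD k ≋ Z ⊛ G endU (suc k)
G-endUD k = ≋Z⊛ {G endUD k} {G endU (suc k)} (λ j → refl) (λ n j → G-suc endUD k n j)

G-endD : ∀ k → G endD k ≋ Z ⊛ (G none (suc k) ⊕ (G endUD (suc k) ⊕ Y (suc k)))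
G-endD k = ≋Z⊛ {G endD k} {G none (suc k) ⊕ (G endUD (suc k) ⊕ Y (suc k))} (λ j → refl) (λ n j → G-suc endD k n j)

G-endL : ∀ k → G endL k ≋ Z ⊛ (G none (suc k) ⊕ (T ⊛ G endUD (suc k) ⊕ Y (suc k)))
G-endL k = ≋Z⊛ {G endL k} {G none (suc k) ⊕ (T ⊛ G endUD (suc k) ⊕ Y (suc k))} (λ j → refl) (λ n → λ
  { zero    → trans (G-suc endL k n 0) (sym (cong (λ x → G none (suc k) n 0 ℤ.+ (x ℤ.+ Y (suc k) n 0)) (T⊛-zero (G endUD (suc k)) n)))
  ; (suc j) → trans (G-suc endL k n (suc j)) (sym (cong (λ x → G none (suc k) n (suc j) ℤ.+ (x ℤ.+ Y (suc k) n (suc j))) (T⊛-suc (G endUD (suc k)) n j))) })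

A-split : ∀ k → A k ≋ G none k ⊕ (G endU k ⊕ (G endUD k ⊕ (G endD k ⊕ G endL k)))
A-split k n j = trans (cong +_ (a≡sum-paths n j k)) (+-sum (map (λ c → paths n ⟨ c , j , k ⟩) tails))

G-endUD-P : ∀ k → G endUD k ≋ Z ^ₛ 2 ⊛ P k
G-endUD-P k = begin
  G endUD k                ≈⟨ G-endUD k ⟩
  Z ⊛ G endU (suc k)       ≈⟨ ⊛-congˡ {Z} (G-endU (suc k)) ⟩
  Z ⊛ (Z ⊛ P k)            ≈⟨ ≋-sym (Z²⊛≋Z⊛Z⊛ (P k)) ⟩
  Z ^ₛ 2 ⊛ P k             ∎
  where open ≋-Reasoning

G-endD-P : ∀ k → G endD k ≋ Z ^ₛ 3 ⊛ P (suc k) ⊕ Z ⊛ Y (suc k)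
G-endD-P k = begin
  G endD k                                               ≈⟨ G-endD k ⟩
  Z ⊛ (G none (suc k) ⊕ (G endUD (suc k) ⊕ Y (suc k)))   ≈⟨ ⊛-congˡ {Z} (⊕-cong (G-none (suc k)) (⊕-congʳ {g = Y (suc k)} (G-endUD-P (suc k)))) ⟩
  Z ⊛ (𝟘 ⊕ (Z ^ₛ 2 ⊛ P (suc k) ⊕ Y (suc k)))            ≈⟨ solve 3 (λ z p y → z :* (con (+ 0) :+ (z :^ 2 :* p :+ y)) := z :^ 3 :* p :+ z :* y)
                                                               (λ _ _ → refl) Z (P (suc k)) (Y (suc k)) ⟩
  Z ^ₛ 3 ⊛ P (suc k) ⊕ Z ⊛ Y (suc k)                     ∎
  where open ≋-Reasoning

G-endL-P : ∀ k → G endL k ≋ Z ^ₛ 3 ⊛ T ⊛ P (suc k) ⊕ Z ⊛ Y (suc k)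
G-endL-P k = begin
  G endL k                                                     ≈⟨ G-endL k ⟩
  Z ⊛ (G none (suc k) ⊕ (T ⊛ G endUD (suc k) ⊕ Y (suc k)))     ≈⟨ ⊛-congˡ {Z} (⊕-cong (G-none (suc k))
                                                                     (⊕-congʳ {g = Y (suc k)} (⊛-congˡ {T} (G-endUD-P (suc k))))) ⟩
  Z ⊛ (𝟘 ⊕ (T ⊛ (Z ^ₛ 2 ⊛ P (suc k)) ⊕ Y (suc k)))              ≈⟨ solve 4 (λ z t p y → z :* (con (+ 0) :+ (t :* (z :^ 2 :* p) :+ y))
                                                                              := z :^ 3 :* t :* p :+ z :* y)
                                                                     (λ _ _ → refl) Z T (P (suc k)) (Y (suc k)) ⟩
  Z ^ₛ 3 ⊛ T ⊛ P (suc k) ⊕ Z ⊛ Y (suc k)                       ∎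
  where open ≋-Reasoning

P-equation : ∀ k → P k ≋ initial k ⊕ afterU k ⊕ Z ^ₛ 2 ⊛ P k ⊕ Z ^ₛ 3 ⊛ P (suc k) ⊕ Z ⊛ Y (suc k)
P-equation k = begin
  P k                                                                            ≈⟨ ⊕-cong (G-none k) (⊕-cong (G-endU k) (⊕-cong (G-endUD-P k) (G-endD-P k))) ⟩
  initial k ⊕ (afterU k ⊕ (Z ^ₛ 2 ⊛ P k ⊕ (Z ^ₛ 3 ⊛ P (suc k) ⊕ Z ⊛ Y (suc k))))   ≈⟨ solve 6 (λ i u z p p′ y → i :+ (u :+ (z :^ 2 :* p :+ (z :^ 3 :* p′ :+ z :* y)))
                                                                                        := i :+ u :+ z :^ 2 :* p :+ z :^ 3 :* p′ :+ z :* y)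
                                                                                    (λ _ _ → refl) (initial k) (afterU k) Z (P k) (P (suc k)) (Y (suc k)) ⟩
  initial k ⊕ afterU k ⊕ Z ^ₛ 2 ⊛ P k ⊕ Z ^ₛ 3 ⊛ P (suc k) ⊕ Z ⊛ Y (suc k)         ∎
  where open ≋-Reasoning

Y-equation : ∀ k → Y k ≋ Z ^ₛ 3 ⊛ (𝟙 ⊕ T) ⊛ P (suc k) ⊕ cst (+ 2) ⊛ Z ⊛ Y (suc k)
Y-equation k = begin
  Y k                                                                       ≈⟨ ⊕-cong (G-endD-P k) (G-endL-P k) ⟩
  Z ^ₛ 3 ⊛ P (suc k) ⊕ Z ⊛ Y (suc k) ⊕ (Z ^ₛ 3 ⊛ T ⊛ P (suc k) ⊕ Z ⊛ Y (suc k)) ≈⟨ solve 4 (λ z t p y → z :^ 3 :* p :+ z :* y :+ (z :^ 3 :* t :* p :+ z :* y)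
                                                                                     := z :^ 3 :* (con (+ 1) :+ t) :* p :+ con (+ 2) :* z :* y)
                                                                                 (λ _ _ → refl) Z T (P (suc k)) (Y (suc k)) ⟩
  Z ^ₛ 3 ⊛ (𝟙 ⊕ T) ⊛ P (suc k) ⊕ cst (+ 2) ⊛ Z ⊛ Y (suc k)                  ∎
  where open ≋-Reasoning

A-equation : ∀ k → A k ≋ P k ⊕ (Z ^ₛ 3 ⊛ T ⊛ P (suc k) ⊕ Z ⊛ Y (suc k))
A-equation k = begin
  A k                                                        ≈⟨ A-split k ⟩
  G none k ⊕ (G endU k ⊕ (G endUD k ⊕ (G endD k ⊕ G endL k)))   ≈⟨ solve 5 (λ e u x d l → e :+ (u :+ (x :+ (d :+ l))) := e :+ (u :+ (x :+ d)) :+ l)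
                                                                    (λ _ _ → refl) (G none k) (G endU k) (G endUD k) (G endD k) (G endL k) ⟩
  P k ⊕ G endL k                                             ≈⟨ ⊕-congˡ {P k} (G-endL-P k) ⟩
  P k ⊕ (Z ^ₛ 3 ⊛ T ⊛ P (suc k) ⊕ Z ⊛ Y (suc k))             ∎
  where open ≋-Reasoning

-- The kernel method

module KernelMethod (ε : Series) (Qε≋0 : reducedCubic ε ≋ 𝟘) where

  -- y = (v - v² - z² v - z⁴) / z², which makes candidate solve the w-equations identically
  v y : Series
  v = 𝟙 ⊕ Z ^ₛ 2 ⊛ ε
  y = ⊖ ε ⊝ 𝟙 ⊝ Z ^ₛ 2 ⊛ (ε ^ₛ 2 ⊕ ε ⊕ 𝟙)

  vᴱ yᴱ : ∀ {m} (z ε : Expr ℤ m) → Expr ℤ m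
  vᴱ z ε = con (+ 1) :+ z :^ 2 :* ε
  yᴱ z ε = :- ε :- con (+ 1) :- z :^ 2 :* (ε :^ 2 :+ ε :+ con (+ 1))

  data Unknown : Set where
    w u : ℕ → Unknown

  start : (Unknown → Series) → ℕ → Series
  start F zero    = 𝟙
  start F (suc k) = Z ⊛ F (w k)

  -- P-equation and Y-equation multiplied by v^(k+2), with v ⊛ f rewritten as f ⊕ Z ^ₛ 2 ⊛ ε ⊛ f
  -- so that the unknowns only occur under a factor z.
  system : (Unknown → Series) → (Unknown → Series)
  system F (w k) = v ⊛ v ⊛ start F k
                   ⊕ Z ⊛ (Z ⊛ v ⊛ F (w k) ⊕ Z ^ₛ 2 ⊛ F (w (suc k)) ⊕ F (u (suc k)) ⊝ Z ⊛ ε ⊛ F (w k))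
  system F (u k) = Z ⊛ (Z ^ₛ 2 ⊛ (𝟙 ⊕ T) ⊛ F (w (suc k)) ⊕ cst (+ 2) ⊛ F (u (suc k)) ⊝ Z ⊛ ε ⊛ F (u k))

  system-contractive : ContractiveFamily system
  system-contractive n F G F≈G (w k) =
    ≈[<]-⊕ (≈[<]-⊛ (≈[<]-refl {f = v ⊛ v}) (start-≈ k))
           (Z⊛-≈[<] (≈[<]-⊕ (≈[<]-⊕ (≈[<]-⊕ (≈[<]-⊛ (≈[<]-refl {f = Z ⊛ v}) (F≈G (w k)))
                                          (≈[<]-⊛ (≈[<]-refl {f = Z ^ₛ 2}) (F≈G (w (suc k)))))
                                   (F≈G (u (suc k))))
                            (≈[<]-⊖ (≈[<]-⊛ (≈[<]-refl {f = Z ⊛ ε}) (F≈G (w k))))))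
    where
    start-≈ : ∀ k → start F k ≈[< suc n ] start G k
    start-≈ zero    = ≈[<]-refl
    start-≈ (suc k) = Z⊛-≈[<] (F≈G (w k))
  system-contractive n F G F≈G (u k) =
    Z⊛-≈[<] (≈[<]-⊕ (≈[<]-⊕ (≈[<]-⊛ (≈[<]-refl {f = Z ^ₛ 2 ⊛ (𝟙 ⊕ T)}) (F≈G (w (suc k))))
                            (≈[<]-⊛ (≈[<]-refl {f = cst (+ 2)}) (F≈G (u (suc k)))))
                     (≈[<]-⊖ (≈[<]-⊛ (≈[<]-refl {f = Z ⊛ ε}) (F≈G (u k)))))

  candidate : Unknown → Series
  candidate (w k) = Z ^ₛ k
  candidate (u k) = Z ^ₛ k ⊛ y

  candidate-solves : ∀ i → system candidate i ≋ candidate i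
  candidate-solves (w zero)    = solve 2 (λ z ε → let v = vᴱ z ε in
      v :* v :* con (+ 1) :+ z :* (z :* v :* con (+ 1) :+ z :^ 2 :* z :^ 1 :+ z :^ 1 :* yᴱ z ε :- z :* ε :* con (+ 1))
    := con (+ 1)) (λ _ _ → refl) Z ε
  candidate-solves (w (suc k)) = solve 3 (λ z ε zᵏ → let v = vᴱ z ε in
      v :* v :* (z :* zᵏ) :+ z :* (z :* v :* (z :* zᵏ) :+ z :^ 2 :* (z :* (z :* zᵏ)) :+ z :* (z :* zᵏ) :* yᴱ z ε :- z :* ε :* (z :* zᵏ))
    := z :* zᵏ) (λ _ _ → refl) Z ε (Z ^ₛ k)
  candidate-solves (u k)       = begin
    system candidate (u k)                     ≈⟨ solve 4 (λ z t ε zᵏ →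
                                                      z :* (z :^ 2 :* (con (+ 1) :+ t) :* (z :* zᵏ) :+ con (+ 2) :* (z :* zᵏ :* yᴱ z ε) :- z :* ε :* (zᵏ :* yᴱ z ε))
                                                   := zᵏ :* yᴱ z ε :+ zᵏ :* reducedCubicᴱ z t ε) (λ _ _ → refl) Z T ε (Z ^ₛ k) ⟩
    Z ^ₛ k ⊛ y ⊕ Z ^ₛ k ⊛ reducedCubic ε      ≈⟨ ⊕-congˡ {Z ^ₛ k ⊛ y} (⊛-congˡ {Z ^ₛ k} Qε≋0) ⟩
    Z ^ₛ k ⊛ y ⊕ Z ^ₛ k ⊛ 𝟘                   ≈⟨ solve 2 (λ zᵏ y → zᵏ :* y :+ zᵏ :* con (+ 0) := zᵏ :* y) (λ _ _ → refl) (Z ^ₛ k) y ⟩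
    Z ^ₛ k ⊛ y                                ∎
    where open ≋-Reasoning

  actual : Unknown → Series
  actual (w k) = v ^ₛ suc k ⊛ P k
  actual (u k) = v ^ₛ suc k ⊛ Y k

  actual-solves : ∀ i → system actual i ≋ actual i
  actual-solves (w zero)    = ≋-sym (≋-by-scaled-difference (v ^ₛ 2) (solve 5 (λ z ε p p′ y′ → let v = vᴱ z ε in
        v :^ 1 :* p :- (v :* v :* con (+ 1) :+ z :* (z :* v :* (v :^ 1 :* p) :+ z :^ 2 :* (v :^ 2 :* p′) :+ v :^ 2 :* y′ :- z :* ε :* (v :^ 1 :* p)))
      := v :^ 2 :* (p :- (con (+ 1) :+ con (+ 0) :+ z :^ 2 :* p :+ z :^ 3 :* p′ :+ z :* y′)))
    (λ _ _ → refl) Z ε (P 0) (P 1) (Y 1)) (P-equation 0))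
  actual-solves (w (suc k)) = ≋-sym (≋-by-scaled-difference (v ^ₛ suc (suc (suc k))) (solve 7 (λ z ε vᵏ p p′ p″ y″ → let v = vᴱ z ε in
        v :* (v :* vᵏ) :* p′
        :- (v :* v :* (z :* (v :* vᵏ :* p)) :+ z :* (z :* v :* (v :* (v :* vᵏ) :* p′) :+ z :^ 2 :* (v :* (v :* (v :* vᵏ)) :* p″)
                                                  :+ v :* (v :* (v :* vᵏ)) :* y″ :- z :* ε :* (v :* (v :* vᵏ) :* p′)))
      := v :* (v :* (v :* vᵏ)) :* (p′ :- (con (+ 0) :+ z :* p :+ z :^ 2 :* p′ :+ z :^ 3 :* p″ :+ z :* y″)))
    (λ _ _ → refl) Z ε (v ^ₛ k) (P k) (P (suc k)) (P (suc (suc k))) (Y (suc (suc k)))) (P-equation (suc k)))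
  actual-solves (u k)       = ≋-sym (≋-by-scaled-difference (v ^ₛ suc (suc k)) (solve 7 (λ z t ε vᵏ y p′ y′ → let v = vᴱ z ε in
        v :* vᵏ :* y :- z :* (z :^ 2 :* (con (+ 1) :+ t) :* (v :* (v :* vᵏ) :* p′) :+ con (+ 2) :* (v :* (v :* vᵏ) :* y′) :- z :* ε :* (v :* vᵏ :* y))
      := v :* (v :* vᵏ) :* (y :- (z :^ 3 :* (con (+ 1) :+ t) :* p′ :+ con (+ 2) :* z :* y′)))
    (λ _ _ → refl) Z T ε (v ^ₛ k) (Y k) (P (suc k)) (Y (suc k))) (Y-equation k))

  actual≋candidate : ∀ i → actual i ≋ candidate i
  actual≋candidate = contractiveFamily-fixedPoint-unique system system-contractive actual candidate actual-solves candidate-solves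

  v-cancel : ∀ f → v ⊛ f ≋ 𝟘 → f ≋ 𝟘
  v-cancel f vf≋0 = unit-cancel (Z ⊛ ε) f
    (≋-trans (⊛-congʳ {g = f} (solve 2 (λ z ε → con (+ 1) :+ z :* (z :* ε) := vᴱ z ε) (λ _ _ → refl) Z ε)) vf≋0)

  A-formula : ∀ k → Z ^ₛ 2 ⊛ v ^ₛ k ⊛ A k ≋ Z ^ₛ k ⊛ (𝟙 ⊝ v)
  A-formula k = ⊝≋𝟘⇒≋ (v-cancel _ (v-cancel _ (begin
    v ⊛ (v ⊛ (Z ^ₛ 2 ⊛ v ^ₛ k ⊛ A k ⊝ Z ^ₛ k ⊛ (𝟙 ⊝ v)))
      ≈⟨ ⊛-congˡ {v} (⊛-congˡ {v} (⊕-congʳ {g = ⊖ (Z ^ₛ k ⊛ (𝟙 ⊝ v))} (⊛-congˡ {Z ^ₛ 2 ⊛ v ^ₛ k} (A-equation k)))) ⟩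
    v ⊛ (v ⊛ (Z ^ₛ 2 ⊛ v ^ₛ k ⊛ (P k ⊕ (Z ^ₛ 3 ⊛ T ⊛ P (suc k) ⊕ Z ⊛ Y (suc k))) ⊝ Z ^ₛ k ⊛ (𝟙 ⊝ v)))
      ≈⟨ solve 8 (λ z t ε vᵏ zᵏ p p′ y′ → let v = vᴱ z ε in
             v :* (v :* (z :^ 2 :* vᵏ :* (p :+ (z :^ 3 :* t :* p′ :+ z :* y′)) :- zᵏ :* (con (+ 1) :- v)))
          := z :^ 2 :* (v :* (v :* vᵏ :* p :- zᵏ) :+ z :^ 3 :* t :* (v :* (v :* vᵏ) :* p′ :- z :* zᵏ)
                        :+ z :* (v :* (v :* vᵏ) :* y′ :- z :* zᵏ :* yᴱ z ε))
             :+ zᵏ :* z :^ 2 :* reducedCubicᴱ z t ε)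
          (λ _ _ → refl) Z T ε (v ^ₛ k) (Z ^ₛ k) (P k) (P (suc k)) (Y (suc k)) ⟩
    Z ^ₛ 2 ⊛ (v ⊛ (actual (w k) ⊝ candidate (w k)) ⊕ Z ^ₛ 3 ⊛ T ⊛ (actual (w (suc k)) ⊝ candidate (w (suc k)))
              ⊕ Z ⊛ (actual (u (suc k)) ⊝ candidate (u (suc k))))
      ⊕ Z ^ₛ k ⊛ Z ^ₛ 2 ⊛ reducedCubic ε
      ≈⟨ ⊕-cong (⊛-congˡ {Z ^ₛ 2} (⊕-cong (⊕-cong (⊛-congˡ {v} (≋⇒⊝≋𝟘 (actual≋candidate (w k))))
                                                  (⊛-congˡ {Z ^ₛ 3 ⊛ T} (≋⇒⊝≋𝟘 (actual≋candidate (w (suc k))))))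
                                          (⊛-congˡ {Z} (≋⇒⊝≋𝟘 (actual≋candidate (u (suc k)))))))
                (⊛-congˡ {Z ^ₛ k ⊛ Z ^ₛ 2} Qε≋0) ⟩
    Z ^ₛ 2 ⊛ (v ⊛ 𝟘 ⊕ Z ^ₛ 3 ⊛ T ⊛ 𝟘 ⊕ Z ⊛ 𝟘) ⊕ Z ^ₛ k ⊛ Z ^ₛ 2 ⊛ 𝟘
      ≈⟨ solve 4 (λ z t v zᵏ → z :^ 2 :* (v :* con (+ 0) :+ z :^ 3 :* t :* con (+ 0) :+ z :* con (+ 0)) :+ zᵏ :* z :^ 2 :* con (+ 0)
                              := con (+ 0)) (λ _ _ → refl) Z T v (Z ^ₛ k) ⟩
    𝟘 ∎)))
    where open ≋-Reasoning

  A₀≋⊖ε : A 0 ≋ ⊖ ε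
  A₀≋⊖ε = ⊝≋𝟘⇒≋ (Z²⊛-cancel _ (begin
    Z ^ₛ 2 ⊛ (A 0 ⊝ ⊖ ε)                ≈⟨ solve 3 (λ z ε a → z :^ 2 :* (a :- :- ε) := z :^ 2 :* vᴱ z ε :^ 0 :* a :- z :^ 0 :* (con (+ 1) :- vᴱ z ε))
                                            (λ _ _ → refl) Z ε (A 0) ⟩
    Z ^ₛ 2 ⊛ v ^ₛ 0 ⊛ A 0 ⊝ Z ^ₛ 0 ⊛ (𝟙 ⊝ v) ≈⟨ ≋⇒⊝≋𝟘 (A-formula 0) ⟩
    𝟘                                    ∎))
    where open ≋-Reasoning

A-formula : ∀ v → IsU1 v → ∀ k → Z ^ₛ 2 ⊛ v ^ₛ k ⊛ A k ≋ Z ^ₛ k ⊛ (𝟙 ⊝ v)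
A-formula v isU1 k = begin
  Z ^ₛ 2 ⊛ v ^ₛ k ⊛ A k      ≈⟨ ⊛-congʳ {g = A k} (⊛-congˡ {Z ^ₛ 2} (^ₛ-cong {v} {v′} k v≋1+Z²ε)) ⟩
  Z ^ₛ 2 ⊛ v′ ^ₛ k ⊛ A k     ≈⟨ KernelMethod.A-formula ε (IsU1⇒reducedCubic≋𝟘 {v} isU1) k ⟩
  Z ^ₛ k ⊛ (𝟙 ⊝ v′)          ≈⟨ ⊛-congˡ {Z ^ₛ k} (⊕-congˡ {𝟙} (⊖-cong (≋-sym v≋1+Z²ε))) ⟩
  Z ^ₛ k ⊛ (𝟙 ⊝ v)           ∎
  where
  open ≋-Reasoning
  ε  = shift² v
  v′ = 𝟙 ⊕ Z ^ₛ 2 ⊛ ε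
  v≋1+Z²ε : v ≋ v′
  v≋1+Z²ε = IsU1⇒≋1+Z²⊛ isU1

-- The series R

-- reducedCubic with z² abstracted to s, written so that every product has an even left factor
-- when s = Z ^ₛ 2 and ε is even, as halve-⊛ requires.
reducedCubicIn : Series → Series → Series
reducedCubicIn s ε = ε ⊕ 𝟙 ⊝ s ⊕ cst (+ 2) ⊛ (s ⊛ (ε ⊛ ε)) ⊕ s ⊛ (s ⊛ (ε ⊛ (ε ⊛ ε) ⊝ ε ⊛ ε ⊝ ε ⊝ 𝟙 ⊕ T))

reducedCubic≋reducedCubicIn-Z² : ∀ ε → reducedCubic ε ≋ reducedCubicIn (Z ^ₛ 2) ε
reducedCubic≋reducedCubicIn-Z² ε = solve 3 (λ z t ε → reducedCubicᴱ z t ε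
  := ε :+ con (+ 1) :- z :^ 2 :+ con (+ 2) :* (z :^ 2 :* (ε :* ε))
       :+ z :^ 2 :* (z :^ 2 :* (ε :* (ε :* ε) :- ε :* ε :- ε :- con (+ 1) :+ t))) (λ _ _ → refl) Z T ε

halve-reducedCubicIn : ∀ ε → Even ε → halve (reducedCubicIn (Z ^ₛ 2) ε) ≋ reducedCubicIn Z (halve ε)
halve-reducedCubicIn ε ε-even =
  ⊕-cong (⊕-cong (⊕-cong (⊕-congˡ {halve ε} (halve-cst (+ 1))) (⊖-cong halve-Z²))
                  (halve-2⊛ {Z ^ₛ 2 ⊛ (ε ⊛ ε)} (halve-Z²⊛ {ε ⊛ ε} halve-ε²)))
         (halve-Z²⊛ {Z ^ₛ 2 ⊛ inner} (halve-Z²⊛ {inner}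
           (⊕-cong (⊕-cong (⊕-cong (⊕-cong halve-ε³ (⊖-cong halve-ε²)) (≋-refl {⊖ halve ε})) (⊖-cong (halve-cst (+ 1)))) halve-T)))
  where
  inner = ε ⊛ (ε ⊛ ε) ⊝ ε ⊛ ε ⊝ ε ⊝ 𝟙 ⊕ T
  halve-ε² : halve (ε ⊛ ε) ≋ halve ε ⊛ halve ε
  halve-ε² = halve-⊛ ε ε ε-even
  halve-ε³ : halve (ε ⊛ (ε ⊛ ε)) ≋ halve ε ⊛ (halve ε ⊛ halve ε)
  halve-ε³ = ≋-trans (halve-⊛ ε (ε ⊛ ε) ε-even) (⊛-congˡ {halve ε} halve-ε²)
  halve-Z²⊛ : ∀ {f f′} → halve f ≋ f′ → halve (Z ^ₛ 2 ⊛ f) ≋ Z ⊛ f′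
  halve-Z²⊛ {f} hf≋f′ = ≋-trans (halve-⊛ (Z ^ₛ 2) f Z²-even) (⊛-cong halve-Z² hf≋f′)
  halve-2⊛ : ∀ {f f′} → halve f ≋ f′ → halve (cst (+ 2) ⊛ f) ≋ cst (+ 2) ⊛ f′
  halve-2⊛ {f} hf≋f′ = ≋-trans (halve-⊛ (cst (+ 2)) f (cst-even (+ 2))) (⊛-cong (halve-cst (+ 2)) hf≋f′)

eqRᴱ : ∀ {m} (z t r : Expr ℤ m) → Expr ℤ m
eqRᴱ z t r = z :^ 2 :* r :^ 3 :- z :* (con (+ 2) :- z) :* r :^ 2 :+ (con (+ 1) :- z :^ 2) :* r
             :- con (+ 1) :+ z :+ z :^ 2 :- t :* z :^ 2

eqR-cong : ∀ {f g} → f ≋ g → eqR f ≋ eqR g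
eqR-cong {f} {g} f≋g = polynomial-cong (eqRᴱ (Ι (suc zero)) (Ι (suc (suc zero))) (Ι zero))
  {f ∷ Z ∷ T ∷ []} {g ∷ Z ∷ T ∷ []} (≋-∷ (Z ∷ T ∷ []) f≋g)

eqR-⊖ : ∀ h → eqR (⊖ h) ≋ ⊖ reducedCubicIn Z h
eqR-⊖ h = solve 3 (λ z t h → eqRᴱ z t (:- h)
  := :- (h :+ con (+ 1) :- z :+ con (+ 2) :* (z :* (h :* h)) :+ z :* (z :* (h :* (h :* h) :- h :* h :- h :- con (+ 1) :+ t))))
  (λ _ _ → refl) Z T h

eqR-solution-unique : ∀ S R → eqR S ≋ 𝟘 → eqR R ≋ 𝟘 → S ≋ R
eqR-solution-unique S R eqR-S≋0 eqR-R≋0 = ⊝≋𝟘⇒≋ (≋Z⊛g⊛h⇒≋𝟘 (⊖ W) (S ⊝ R) (begin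
  S ⊝ R                                       ≈⟨ solve 4 (λ z t s r → s :- r
                                                     := z :* (:- (z :* (s :* s :+ s :* r :+ r :* r) :- (con (+ 2) :- z) :* (s :+ r) :- z) :* (s :- r))
                                                        :+ (eqRᴱ z t s :- eqRᴱ z t r))
                                                   (λ _ _ → refl) Z T S R ⟩
  Z ⊛ (⊖ W ⊛ (S ⊝ R)) ⊕ (eqR S ⊝ eqR R)       ≈⟨ ⊕-congˡ {Z ⊛ (⊖ W ⊛ (S ⊝ R))} (⊕-cong eqR-S≋0 (⊖-cong eqR-R≋0)) ⟩
  Z ⊛ (⊖ W ⊛ (S ⊝ R)) ⊕ (𝟘 ⊝ 𝟘)               ≈⟨ solve 1 (λ x → x :+ (con (+ 0) :- con (+ 0)) := x) (λ _ _ → refl) (Z ⊛ (⊖ W ⊛ (S ⊝ R))) ⟩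
  Z ⊛ (⊖ W ⊛ (S ⊝ R))                         ∎))
  where
  open ≋-Reasoning
  W = Z ⊛ (S ⊛ S ⊕ S ⊛ R ⊕ R ⊛ R) ⊝ (cst (+ 2) ⊝ Z) ⊛ (S ⊕ R) ⊝ Z

open KernelMethod ε₀ reducedCubic-ε₀ using (A₀≋⊖ε)

parity-odd : ∀ n → parity (suc (n + n)) ≡ parity 0 ⁻¹
parity-odd n = trans (parity-suc (n + n)) (cong _⁻¹ (trans (+-homo-+ n n) (p+p≡0ℙ (parity n))))

a-odd-level0 : ∀ n j → a (suc (n + n)) j 0 ≡ 0
a-odd-level0 n j = trans (a≡sum-paths (suc (n + n)) j 0)
  (trans (sum-map-cong tails (λ c → paths-parity (suc (n + n)) ⟨ c , j , 0 ⟩ (parity-odd n))) (sum-map-zero tails))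

ε₀-even : Even ε₀
ε₀-even n j = trans (sym (ℤₚ.neg-involutive _))
  (trans (cong ℤ.-_ (sym (A₀≋⊖ε (suc (n + n)) j))) (cong (λ x → ℤ.- (+ x)) (a-odd-level0 n j)))

Rser≋⊖halve-ε₀ : Rser ≋ ⊖ halve ε₀
Rser≋⊖halve-ε₀ n j = A₀≋⊖ε (n + n) j

eqR-Rser : eqR Rser ≋ 𝟘
eqR-Rser = begin
  eqR Rser                              ≈⟨ eqR-cong Rser≋⊖halve-ε₀ ⟩
  eqR (⊖ halve ε₀)                      ≈⟨ eqR-⊖ (halve ε₀) ⟩
  ⊖ reducedCubicIn Z (halve ε₀)         ≈⟨ ⊖-cong (≋-sym (halve-reducedCubicIn ε₀ ε₀-even)) ⟩
  ⊖ halve (reducedCubicIn (Z ^ₛ 2) ε₀)  ≈⟨ ⊖-cong (halve-cong (≋-trans (≋-sym (reducedCubic≋reducedCubicIn-Z² ε₀)) reducedCubic-ε₀)) ⟩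
  ⊖ halve 𝟘                             ≈⟨ ⊖-cong {halve 𝟘} (halve-cst (+ 0)) ⟩
  ⊖ 𝟘                                   ≈⟨ solve 0 (:- con (+ 0) := con (+ 0)) (λ _ _ → refl) ⟩
  𝟘                                     ∎
  where open ≋-Reasoning

Rser-polynomialCoeffs : PolyCoeffs Rser
Rser-polynomialCoeffs n = n + n , λ j n+n<j → cong +_ (trans (a≡sum-paths (n + n) j 0)
  (trans (sum-map-cong tails (λ c → paths-udl-bound (n + n) ⟨ c , j , 0 ⟩ n+n<j)) (sum-map-zero tails)))

mainTheorem2 :
    (Σ Series IsU1)
    × (∀ v → IsU1 v → ∀ (k : ℕ) →
         Z ^ₛ 2 ⊛ v ^ₛ k ⊛ A k ≋ Z ^ₛ k ⊛ (𝟙 ⊝ v))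
    × (PolyCoeffs Rser × ConstOne Rser × eqR Rser ≋ 𝟘)
    × (∀ S → PolyCoeffs S → ConstOne S → eqR S ≋ 𝟘 → S ≋ Rser)
mainTheorem2 =
    (𝟙 ⊕ Z ^ₛ 2 ⊛ ε₀ , reducedCubic≋𝟘⇒IsU1 {ε₀} reducedCubic-ε₀)
  , A-formula
  , (Rser-polynomialCoeffs , (refl , λ j → refl) , eqR-Rser)
  -- the equation alone determines R
  , λ S _ _ eqR-S≋0 → eqR-solution-unique S Rser eqR-S≋0 eqR-Rser
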